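{- Let $q$ be a positive integer and $a_1,a_2,a_3$ distinct reduced residues mod $q$ with $a_1^2\equiv a_2^2\equiv a_3^2\pmod q$, all quadratic residues or all quadratic nonresidues mod $q$. Then the sets $H_0,H_1,H_2,H_3$ partition the group of Dirichlet characters modulo $q$ into four subsets, each of cardinality $\tfrac14\phi(q)$.
   Context: $H_0=\{\chi\bmod q:\chi(a_1)=\chi(a_2)=\chi(a_3)\}$, $H_1=\{\chi:\chi(a_2)=\chi(a_3)=-\chi(a_1)\}$, $H_2=\{\chi:\chi(a_1)=\chi(a_3)=-\chi(a_2)\}$, $H_3=\{\chi:\chi(a_1)=\chi(a_2)=-\chi(a_3)\}$, where $\chi$ ranges over Dirichlet characters mod $q$. -}

module Defs where

open import Data.Nat using (ℕ; zero; suc; _+_; _*_; _/_; _%_; NonZero)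
open import Data.Nat.DivMod using (m%n<n)
open import Data.Nat.Properties using () renaming (_≟_ to _≟ℕ_)
open import Data.Nat.Divisibility using (_∣_; _∣?_)
open import Data.Nat.GCD using (gcd)
import Data.Fin as Fin
import Data.Empty
open import Data.Fin using (Fin; toℕ; fromℕ<) renaming (_≟_ to _≟F_)
open import Data.Fin.Properties using (all?; any?)
open import Data.Maybe using (Maybe; just; nothing)
open import Data.Maybe.Properties using (≡-dec)
open import Data.Vec using (Vec; []; _∷_; lookup)
open import Data.List using (List; []; _∷_; [_]; map; concatMap; filter; length; allFin)
open import Data.Product using (_×_; _,_; Σ)
open import Data.Unit using (⊤; tt)
open import Data.Empty using (⊥)
open import Relation.Nullary using (¬_; Dec; yes; no; _×-dec_; ¬?)
open import Relation.Unary using (Decidable)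
open import Relation.Binary.PropositionalEquality using (_≡_; refl)

Unit : (q : ℕ) → Fin q → Set
Unit q a = gcd (toℕ a) q ≡ 1

Unit? : (q : ℕ) → Decidable (Unit q)
Unit? q a = gcd (toℕ a) q ≟ℕ 1

mulMod : {q : ℕ} → Fin q → Fin q → Fin q
mulMod {suc n} a b = fromℕ< (m%n<n (toℕ a * toℕ b) (suc n))

QR : (q : ℕ) → Fin q → Set
QR q a = Σ (Fin q) (λ x → mulMod x x ≡ a)

φ : ℕ → ℕ
φ q = length (filter (Unit? q) (allFin q))

-- Every value of a Dirichlet character mod q is 0 or a φ(q)-th root of
-- unity.  We model the value set {0} ∪ μ_N (N = φ(q)) inside ℂ exactly:
--   nothing  ↦ 0,      just k ↦ ζ_N^k   (ζ_N = exp(2πi/N), k : Fin N).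

Val : ℕ → Set
Val N = Maybe (Fin N)

-- ζ^j · ζ^k = ζ^(j+k mod N)
addMod : {N : ℕ} → Fin N → Fin N → Fin N
addMod {suc n} x y = fromℕ< (m%n<n (toℕ x + toℕ y) (suc n))

_·v_ : {N : ℕ} → Val N → Val N → Val N
just x ·v just y = just (addMod x y)
_ ·v _ = nothing

-- Neg x y  :  ζ^y = - ζ^x, i.e. N is even and y ≡ x + N/2 (mod N)
NegR : {N : ℕ} → Fin N → Fin N → Set
NegR {suc n} x y = (2 ∣ suc n) × (toℕ y ≡ (toℕ x + suc n / 2) % suc n)

NegR? : {N : ℕ} → (x y : Fin N) → Dec (NegR x y)
NegR? {suc n} x y = (2 ∣? suc n) ×-dec (toℕ y ≟ℕ ((toℕ x + suc n / 2) % suc n))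

IsNeg : {N : ℕ} → Val N → Val N → Set
IsNeg nothing  nothing  = ⊤
IsNeg (just x) (just y) = NegR x y
IsNeg _        _        = ⊥

IsNeg? : {N : ℕ} → (u v : Val N) → Dec (IsNeg u v)
IsNeg? nothing  nothing  = yes tt
IsNeg? (just x) (just y) = NegR? x y
IsNeg? nothing  (just _) = no (λ ())
IsNeg? (just _) nothing  = no (λ ())

_≟v_ : {N : ℕ} → (u v : Val N) → Dec (u ≡ v)
_≟v_ = ≡-dec _≟F_

Fun : ℕ → Set
Fun q = Vec (Val (φ q)) q

IsChar : (q : ℕ) → Fun q → Set
IsChar q χ =
  ((a b : Fin q) → lookup χ (mulMod a b) ≡ (lookup χ a ·v lookup χ b)) ×
  ((a : Fin q) → (lookup χ a ≡ nothing → ¬ Unit q a) × (¬ Unit q a → lookup χ a ≡ nothing))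

IsChar? : (q : ℕ) → Decidable (IsChar q)
IsChar? q χ =
  all? (λ a → all? (λ b → lookup χ (mulMod a b) ≟v (lookup χ a ·v lookup χ b)))
  ×-dec all? (λ a → (dec→ (lookup χ a ≟v nothing) (¬? (Unit? q a)))
                    ×-dec dec→ (¬? (Unit? q a)) (lookup χ a ≟v nothing))
  where
  dec→ : {A B : Set} → Dec A → Dec B → Dec (A → B)
  dec→ _       (yes b) = yes (λ _ → b)
  dec→ (yes a) (no ¬b) = no (λ f → ¬b (f a))
  dec→ (no ¬a) (no _)  = yes (λ a → Data.Empty.⊥-elim (¬a a))

allVecs : {A : Set} → List A → (n : ℕ) → List (Vec A n)
allVecs xs zero    = [ [] ]
allVecs xs (suc n) = concatMap (λ x → map (x ∷_) (allVecs xs n)) xs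

allVals : (N : ℕ) → List (Val N)
allVals N = nothing ∷ map just (allFin N)

Chars : (q : ℕ) → List (Fun q)
Chars q = filter (IsChar? q) (allVecs (allVals (φ q)) q)

H : (q : ℕ) → (a₁ a₂ a₃ : Fin q) → Fin 4 → Fun q → Set
H q a₁ a₂ a₃ i χ = go i
  where
  c₁ = lookup χ a₁
  c₂ = lookup χ a₂
  c₃ = lookup χ a₃
  go : Fin 4 → Set
  go Fin.zero                         = (c₁ ≡ c₂) × (c₂ ≡ c₃)
  go (Fin.suc Fin.zero)               = (c₂ ≡ c₃) × IsNeg c₁ c₃
  go (Fin.suc (Fin.suc Fin.zero))     = (c₁ ≡ c₃) × IsNeg c₂ c₃
  go (Fin.suc (Fin.suc (Fin.suc _)))  = (c₁ ≡ c₂) × IsNeg c₃ c₂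

H? : (q : ℕ) → (a₁ a₂ a₃ : Fin q) → (i : Fin 4) → Decidable (H q a₁ a₂ a₃ i)
H? q a₁ a₂ a₃ Fin.zero χ =
  (lookup χ a₁ ≟v lookup χ a₂) ×-dec (lookup χ a₂ ≟v lookup χ a₃)
H? q a₁ a₂ a₃ (Fin.suc Fin.zero) χ =
  (lookup χ a₂ ≟v lookup χ a₃) ×-dec IsNeg? (lookup χ a₁) (lookup χ a₃)
H? q a₁ a₂ a₃ (Fin.suc (Fin.suc Fin.zero)) χ =
  (lookup χ a₁ ≟v lookup χ a₃) ×-dec IsNeg? (lookup χ a₂) (lookup χ a₃)
H? q a₁ a₂ a₃ (Fin.suc (Fin.suc (Fin.suc _))) χ =
  (lookup χ a₁ ≟v lookup χ a₂) ×-dec IsNeg? (lookup χ a₃) (lookup χ a₂)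

-- Put b = a₁a₃⁻¹ and c = a₂a₃⁻¹. Then b² = c² = 1 and 1, b, c are distinct, so b and c
-- generate a Klein four-group K. For a character χ the values χ(b), χ(c) are ±1 and
-- χ(a₁) = χ(b)χ(a₃), χ(a₂) = χ(c)χ(a₃), so χ lies in exactly one Hᵢ, the one indexed by the
-- signs (χ(b), χ(c)); thus Hᵢ is the set of characters extending a prescribed character of K.
-- A character ψ of a subgroup S has exactly φ(q)/|S| extensions: adjoining a unit g whose
-- least power in S is gᵐ multiplies |S| by m, and leaves as values for χ(g) the solutions of
-- m·x = ψ(gᵐ) in ℤ/φ(q), of which there are m since m divides both φ(q) and, by Euler's
-- theorem, ψ(gᵐ).

module Submission where

open import Defs
open import Algebra.Bundles using (CommutativeMonoid; AbelianGroup)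
open import Algebra.Core using (Op₂)
open import Algebra.Structures using (IsCommutativeMonoid)
open import Algebra.Structures.Biased using (isCommutativeMonoidˡ)
import Algebra.Properties.CommutativeSemigroup as CommutativeSemigroupProperties
import Algebra.Properties.Group
open import Data.Bool using (Bool; true; false; not)
open import Data.Vec using (Vec; []; _∷_; lookup; tabulate)
open import Data.Vec.Properties using (≡-dec; ∷-injectiveˡ; ∷-injectiveʳ; lookup∘tabulate; tabulate∘lookup; tabulate-cong)
open import Data.Fin using (Fin; zero; suc; toℕ; fromℕ<) renaming (_≟_ to _≟ᶠ_)
open import Data.Fin.Properties using (suc-injective; toℕ-fromℕ<; toℕ-injective; toℕ<n; any?; all?; pigeonhole)
open import Data.List using (List; []; _∷_; [_]; map; filter; length; allFin; concatMap; _++_)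
open import Data.List.Properties using (filter-some; length-++; filter-++; length-tabulate; map-cong; map-cong-local; map-tabulate)
open import Data.List.Relation.Unary.All as All using (All; []; _∷_)
open import Data.List.Relation.Unary.All.Properties using (all-filter)
open import Data.List.Relation.Unary.Any as Any using (here; there)
open import Data.List.Membership.Propositional using () renaming (_∈_ to _∈ˡ_)
open import Data.List.Membership.Propositional.Properties using (∈-allFin)
open import Data.Maybe using (just; nothing)
open import Data.Maybe.Properties using (just-injective)
open import Data.Nat using (ℕ; zero; suc; _+_; _*_; _∸_; _%_; _/_; _<_; _≤_; s≤s; z≤n; NonZero; >-nonZero; >-nonZero⁻¹; ≢-nonZero⁻¹)
open import Data.Nat.DivMod
  using (m%n<n; m<n⇒m%n≡m; m%n%n≡m%n; n%n≡0; m*n/n≡m; %-distribˡ-+; %-distribˡ-*; [m+kn]%n≡m%n; %-remove-+ʳ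
        ; m≡m%n+[m/n]*n; m<n*o⇒m/o<n; m%n*o≡m*o%[n*o])
open import Data.Nat.Divisibility
  using (_∣_; ∣⇒≤; divides; m∣m*n; *-cancelˡ-∣; quotient; m∣n⇒n≡quotient*m; ∣-reflexive; ∣-trans; m%n≡0⇒n∣m
        ; ∣-refl; ∣1⇒≡1; ∣m∣n⇒∣m+n; ∣m⇒∣m*n; ∣n⇒∣m*n; n∣m*n; %-presˡ-∣)
open import Data.Nat.GCD using (gcd; gcd[m,n]∣m; gcd[m,n]∣n; module Bézout)
open import Data.Nat.Coprimality using (gcd≡1⇒coprime; coprime-Bézout)
open import Data.Nat.ListAction using (sum)
open import Data.Nat.Properties
  using (≤-antisym; ≤∧≢⇒<; m<m+n; +-monoʳ-≤; _≟_; <-≤-trans; +-monoˡ-<; *-monoˡ-≤; *-cancelʳ-≡; *-cancelʳ-<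
        ; +-cancelˡ-≡; m*n≢0⇒m≢0; ≤-total; ≤-<-trans; m∸n≤m; ≤⇒≯; m≤m+n; n<1+n; m+[n∸m]≡n; +-suc; +-comm
        ; *-comm; *-assoc; +-identityʳ; *-identityʳ; *-zeroʳ; *-distribʳ-+; m∸n+n≡m; <⇒≤
        ; +-commutativeSemigroup; *-commutativeSemigroup; *-cancelˡ-≡; +-0-isCommutativeMonoid
        ; *-1-isCommutativeMonoid)
open import Data.Product using (_×_; _,_; Σ; proj₁; proj₂; ∃-syntax; uncurry)
open import Data.Product.Properties using (×-≡,≡→≡)
open import Data.Product.Function.NonDependent.Propositional using (_×-⇔_)
open import Data.Sum using (_⊎_; inj₁; inj₂; [_,_]′)
open import Function using (_∘_; id; flip; _⇔_; mk⇔; Equivalence)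
open import Function.Properties.Equivalence using () renaming (trans to ⇔-trans; sym to ⇔-sym)
open import Level using (0ℓ)
open import Relation.Nullary using (¬_; Dec; yes; no; contradiction; _×-dec_; _→-dec_)
open import Relation.Unary using (Pred; Decidable)
open import Relation.Binary using (DecidableEquality)
import Relation.Binary.PropositionalEquality as ≡
open import Relation.Binary.PropositionalEquality using (_≡_; _≢_; refl; sym; trans; cong; cong₂; subst; module ≡-Reasoning)

open ≡-Reasoning

-- Counting

count : {A : Set} {P : Pred A 0ℓ} → Decidable P → List A → ℕ
count P? xs = length (filter P? xs)

module _ {A : Set} {P : Pred A 0ℓ} (P? : Decidable P) where

  count-∷ : ∀ x xs → count P? (x ∷ xs) ≡ count P? [ x ] + count P? xs
  count-∷ x xs with P? x
  ... | yes _ = refl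
  ... | no _  = refl

  count-++ : ∀ xs ys → count P? (xs ++ ys) ≡ count P? xs + count P? ys
  count-++ xs ys = trans (cong length (filter-++ P? xs ys)) (length-++ (filter P? xs))

  count-accept : ∀ {x} → P x → count P? [ x ] ≡ 1
  count-accept {x} px with P? x
  ... | yes _  = refl
  ... | no ¬px = contradiction px ¬px

  count-reject : ∀ {x} → ¬ P x → count P? [ x ] ≡ 0
  count-reject {x} ¬px with P? x
  ... | yes px = contradiction px ¬px
  ... | no _   = refl

  count≡sum : ∀ xs → count P? xs ≡ sum (map (λ x → count P? [ x ]) xs)
  count≡sum []       = refl
  count≡sum (x ∷ xs) = trans (count-∷ x xs) (cong (count P? [ x ] +_) (count≡sum xs))

  count-none : ∀ {xs} → All (¬_ ∘ P) xs → count P? xs ≡ 0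
  count-none []                 = refl
  count-none {x ∷ _} (¬px ∷ ¬pxs) with P? x
  ... | yes px = contradiction px ¬px
  ... | no _   = count-none ¬pxs

module _ {A : Set} {P Q : Pred A 0ℓ} (P? : Decidable P) (Q? : Decidable Q) where

  count-cong : ∀ {xs} → All (λ x → (P x → Q x) × (Q x → P x)) xs → count P? xs ≡ count Q? xs
  count-cong []                  = refl
  count-cong {x ∷ _} ((f , g) ∷ h) with P? x | Q? x
  ... | yes _  | yes _  = cong suc (count-cong h)
  ... | yes px | no ¬qx = contradiction (f px) ¬qx
  ... | no ¬px | yes qx = contradiction (g qx) ¬px
  ... | no _   | no _   = count-cong h

  count-filter : ∀ xs → count Q? (filter P? xs) ≡ count (λ x → P? x ×-dec Q? x) xs
  count-filter []       = refl
  count-filter (x ∷ xs) with P? x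
  ... | no _ = count-filter xs
  ... | yes _ with Q? x
  ...   | yes _ = cong suc (count-filter xs)
  ...   | no _  = count-filter xs

module _ {A : Set} where

  sum-map-+ : (f g : A → ℕ) (xs : List A) →
              sum (map (λ x → f x + g x) xs) ≡ sum (map f xs) + sum (map g xs)
  sum-map-+ f g []       = refl
  sum-map-+ f g (x ∷ xs) = trans (cong (f x + g x +_) (sum-map-+ f g xs))
                                 (interchange (f x) (g x) (sum (map f xs)) (sum (map g xs)))
    where open CommutativeSemigroupProperties +-commutativeSemigroup using (interchange)

  sum-map-const : (c : ℕ) (xs : List A) → sum (map (λ _ → c) xs) ≡ length xs * c
  sum-map-const c []       = refl
  sum-map-const c (x ∷ xs) = cong (c +_) (sum-map-const c xs)

  sum-map-*ʳ : (f : A → ℕ) (c : ℕ) (xs : List A) → sum (map f xs) * c ≡ sum (map (λ x → f x * c) xs)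
  sum-map-*ʳ f c []       = refl
  sum-map-*ʳ f c (x ∷ xs) = trans (*-distribʳ-+ c (f x) (sum (map f xs))) (cong (f x * c +_) (sum-map-*ʳ f c xs))

module _ {A B : Set} {R : B → Pred A 0ℓ} (R? : ∀ k → Decidable (R k)) where

  count-[]-swap : ∀ k x → count (R? k) [ x ] ≡ count (λ k → R? k x) [ k ]
  count-[]-swap k x with R? k x
  ... | yes _ = refl
  ... | no _  = refl

  count-swap : ∀ ks xs → sum (map (λ k → count (R? k) xs) ks) ≡ sum (map (λ x → count (λ k → R? k x) ks) xs)
  count-swap ks []       = trans (sum-map-const 0 ks) (*-zeroʳ (length ks))
  count-swap ks (x ∷ xs) = begin
    sum (map (λ k → count (R? k) (x ∷ xs)) ks)
      ≡⟨ cong sum (map-cong (λ k → count-∷ (R? k) x xs) ks) ⟩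
    sum (map (λ k → count (R? k) [ x ] + count (R? k) xs) ks)
      ≡⟨ sum-map-+ (λ k → count (R? k) [ x ]) (λ k → count (R? k) xs) ks ⟩
    sum (map (λ k → count (R? k) [ x ]) ks) + sum (map (λ k → count (R? k) xs) ks)
      ≡⟨ cong₂ _+_ (cong sum (map-cong (λ k → count-[]-swap k x) ks)) (count-swap ks xs) ⟩
    sum (map (λ k → count (λ k → R? k x) [ k ]) ks) + sum (map (λ y → count (λ k → R? k y) ks) xs)
      ≡⟨ cong (_+ _) (count≡sum (λ k → R? k x) ks) ⟨
    count (λ k → R? k x) ks + sum (map (λ y → count (λ k → R? k y) ks) xs) ∎

  -- count P? [ x ] is the indicator of P x: each x satisfying P lies in exactly
  -- one fibre R k, every other x in none.
  count-partition : {P : Pred A 0ℓ} (P? : Decidable P) (ks : List B) (xs : List A) →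
                    All (λ x → count (λ k → R? k x) ks ≡ count P? [ x ]) xs →
                    count P? xs ≡ sum (map (λ k → count (R? k) xs) ks)
  count-partition P? ks xs fibres = begin
    count P? xs                                    ≡⟨ count≡sum P? xs ⟩
    sum (map (λ x → count P? [ x ]) xs)             ≡⟨ cong sum (map-cong-local (All.map sym fibres)) ⟩
    sum (map (λ x → count (λ k → R? k x) ks) xs)    ≡⟨ count-swap ks xs ⟨
    sum (map (λ k → count (R? k) xs) ks)           ∎

module _ {A B : Set} {P : Pred B 0ℓ} (P? : Decidable P) where

  count-map : (f : A → B) (xs : List A) → count P? (map f xs) ≡ count (P? ∘ f) xs
  count-map f []       = refl
  count-map f (x ∷ xs) with P? (f x)
  ... | yes _ = cong suc (count-map f xs)
  ... | no _  = count-map f xs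

  count-concatMap : (f : A → List B) (xs : List A) →
                    count P? (concatMap f xs) ≡ sum (map (λ x → count P? (f x)) xs)
  count-concatMap f []       = refl
  count-concatMap f (x ∷ xs) = trans (count-++ P? (f x) (concatMap f xs)) (cong (count P? (f x) +_) (count-concatMap f xs))

allFin-suc : ∀ n → allFin (suc n) ≡ zero ∷ map suc (allFin n)
allFin-suc n = cong (zero ∷_) (sym (map-tabulate (λ i → i) suc))

count-≟-allFin : ∀ {n} (y : Fin n) → count (_≟ᶠ y) (allFin n) ≡ 1
count-≟-allFin {suc n} y = trans (cong (count (_≟ᶠ y)) (allFin-suc n)) (count-≟-zero∷suc y)
  where
  count-≟-zero∷suc : ∀ y → count (_≟ᶠ y) (zero ∷ map suc (allFin n)) ≡ 1
  count-≟-zero∷suc zero    = cong suc (trans (count-map (_≟ᶠ zero) suc (allFin n))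
                                             (count-none _ (All.universal (λ _ ()) (allFin n))))
  count-≟-zero∷suc (suc y) = begin
    count (_≟ᶠ suc y) (map suc (allFin n))   ≡⟨ count-map (_≟ᶠ suc y) suc (allFin n) ⟩
    count (λ x → suc x ≟ᶠ suc y) (allFin n) ≡⟨ count-cong _ (_≟ᶠ y) (All.universal (λ _ → suc-injective , cong suc) (allFin n)) ⟩
    count (_≟ᶠ y) (allFin n)                ≡⟨ count-≟-allFin y ⟩
    1                                       ∎

count-unique : ∀ {n} {P : Pred (Fin n) 0ℓ} (P? : Decidable P) {y} → P y → (∀ {x} → P x → x ≡ y) →
               count P? (allFin n) ≡ 1
count-unique {n} P? {y} py unique =
  trans (count-cong P? (_≟ᶠ y) (All.universal (λ x → unique , λ { refl → py }) (allFin n))) (count-≟-allFin y)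

count-allVecs : ∀ {A : Set} (_≟_ : DecidableEquality A) {xs : List A} → (∀ a → count (_≟ a) xs ≡ 1) →
                ∀ {n} (v : Vec A n) → count (λ w → ≡-dec _≟_ w v) (allVecs xs n) ≡ 1
count-allVecs _≟_ {xs} once []      = refl
count-allVecs _≟_ {xs} once {suc n} (y ∷ v) = begin
  count (_≟ᵛ (y ∷ v)) (concatMap (λ x → map (x ∷_) (allVecs xs n)) xs)   ≡⟨ count-concatMap (_≟ᵛ (y ∷ v)) _ xs ⟩
  sum (map (λ x → count (_≟ᵛ (y ∷ v)) (map (x ∷_) (allVecs xs n))) xs)
    ≡⟨ cong sum (map-cong (λ x → trans (count-map _ (x ∷_) (allVecs xs n)) (by-head x (x ≟ y))) xs) ⟩
  sum (map (λ x → count (_≟ y) [ x ]) xs)                               ≡⟨ count≡sum (_≟ y) xs ⟨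
  count (_≟ y) xs                                                       ≡⟨ once y ⟩
  1                                                                     ∎
  where
  _≟ᵛ_ : ∀ {k} → DecidableEquality (Vec _ k)
  _≟ᵛ_ = ≡-dec _≟_
  by-head : ∀ x → Dec (x ≡ y) → count (λ w → (x ∷ w) ≟ᵛ (y ∷ v)) (allVecs xs n) ≡ count (_≟ y) [ x ]
  by-head x (yes refl) = trans (count-cong _ (_≟ᵛ v) (All.universal (λ _ → ∷-injectiveʳ , cong (x ∷_)) (allVecs xs n)))
                               (trans (count-allVecs _≟_ {xs} once v) (sym (count-accept (_≟ y) refl)))
  by-head x (no x≢y)   = trans (count-none _ (All.universal (λ _ → x≢y ∘ ∷-injectiveˡ) (allVecs xs n))) (sym (count-reject (_≟ y) x≢y))

count-allVals : ∀ M (a : Val M) → count (_≟v a) (allVals M) ≡ 1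
count-allVals M nothing  = cong suc (trans (count-map (_≟v nothing) just (allFin M)) (count-none _ (All.universal (λ _ ()) (allFin M))))
count-allVals M (just k) = begin
  count (_≟v just k) (map just (allFin M))        ≡⟨ count-map (_≟v just k) just (allFin M) ⟩
  count (λ i → just i ≟v just k) (allFin M)      ≡⟨ count-cong _ (_≟ᶠ k) (All.universal (λ _ → just-injective , cong just) (allFin M)) ⟩
  count (_≟ᶠ k) (allFin M)                       ≡⟨ count-≟-allFin k ⟩
  1                                              ∎

-- Arithmetic

least : {P : Pred ℕ 0ℓ} → Decidable P → ∀ {k} → P k → ∃[ m ] P m × (∀ {j} → j < m → ¬ P j)
least P? pk with P? 0
... | yes p0 = 0 , p0 , λ ()
least P? {zero}  pk | no ¬p0 = contradiction pk ¬p0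
least P? {suc k} pk | no ¬p0 with least (P? ∘ suc) pk
... | m , pm , below = suc m , pm , λ { {zero} _ → ¬p0 ; {suc j} (s≤s j<m) → below j<m }

m∣n⇒n<m⇒n≡0 : ∀ {m n} → m ∣ n → n < m → n ≡ 0
m∣n⇒n<m⇒n≡0 (divides zero    refl) _   = refl
m∣n⇒n<m⇒n≡0 {m} (divides (suc k) refl) n<m = contradiction n<m (≤⇒≯ (m≤m+n m (k * m)))

m*2∣n*2⇒n≡0∨n≡m : ∀ m {n} → n < m * 2 → m * 2 ∣ n * 2 → n ≡ 0 ⊎ n ≡ m
m*2∣n*2⇒n≡0∨n≡m m {n} n<2m (divides j n*2≡j*[m*2]) with *-cancelʳ-≡ n (j * m) 2 (trans n*2≡j*[m*2] (sym (*-assoc j m 2)))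
... | n≡j*m with j
...   | zero          = inj₁ n≡j*m
...   | suc zero      = inj₂ (trans n≡j*m (+-identityʳ m))
...   | suc (suc j′)  = contradiction n<2m (≤⇒≯ (subst (m * 2 ≤_) (sym n≡j*m)
                          (subst (_≤ m + (m + j′ * m)) (sym (trans (*-comm m 2) (cong (m +_) (+-identityʳ m))))
                                 (+-monoʳ-≤ m (m≤m+n m (j′ * m))))))

mod-inverse : ∀ {a q} .{{_ : NonZero q}} → gcd a q ≡ 1 → ∃[ x ] (a * x) % q ≡ 1 % q
mod-inverse {a} {q@(suc p)} gcd≡1 with coprime-Bézout (gcd≡1⇒coprime gcd≡1)
... | Bézout.+- x y eq = x , (begin
  (a * x) % q     ≡⟨ cong (_% q) (trans (*-comm a x) (sym eq)) ⟩
  (1 + y * q) % q ≡⟨ [m+kn]%n≡m%n 1 y q ⟩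
  1 % q           ∎)
-- Here x * a ≡ -1, so the inverse is -x ≡ x * (q - 1).
... | Bézout.-+ x y eq = x * p , (begin
  (a * (x * p)) % q      ≡⟨ cong (_% q) (trans (sym (*-assoc a x p)) (cong (_* p) (*-comm a x))) ⟩
  (x * a * p) % q        ≡⟨ %-remove-+ʳ (x * a * p) {q} ∣-refl ⟨
  (x * a * p + q) % q    ≡⟨ cong (_% q) (trans (+-suc (x * a * p) p) (cong suc (+-comm (x * a * p) p))) ⟩
  suc ((1 + x * a) * p) % q ≡⟨ cong (λ t → suc (t * p) % q) eq ⟩
  (1 + y * q * p) % q    ≡⟨ %-remove-+ʳ 1 (∣m⇒∣m*n p (n∣m*n y)) ⟩
  1 % q                  ∎)

module _ (t m : ℕ) .{{_ : NonZero t}} {v : ℕ} (v<t : v < t) where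

  private
    _≡v+_*t? : (x : Fin (t * m)) (k : Fin m) → Dec (toℕ x ≡ v + toℕ k * t)
    x ≡v+ k *t? = toℕ x ≟ v + toℕ k * t

    v+kt<tm : (k : Fin m) → v + toℕ k * t < t * m
    v+kt<tm k = <-≤-trans (+-monoˡ-< (toℕ k * t) v<t) (subst (suc (toℕ k) * t ≤_) (*-comm m t) (*-monoˡ-≤ t (toℕ<n k)))

    %≡-fibre : ∀ x → Dec (toℕ x % t ≡ v) → count (x ≡v+_*t?) (allFin m) ≡ count (λ x → toℕ x % t ≟ v) [ x ]
    %≡-fibre x (yes x%t≡v) = trans (count-unique (x ≡v+_*t?) {fromℕ< x/t<m} x≡v+[x/t]t
                                     (λ {k} x≡v+kt → toℕ-injective (*-cancelʳ-≡ (toℕ k) _ t (+-cancelˡ-≡ v _ _ (trans (sym x≡v+kt) x≡v+[x/t]t)))))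
                                   (sym (count-accept (λ x → toℕ x % t ≟ v) x%t≡v))
      where
      x/t<m : toℕ x / t < m
      x/t<m = m<n*o⇒m/o<n (subst (toℕ x <_) (*-comm t m) (toℕ<n x))
      x≡v+[x/t]t : toℕ x ≡ v + toℕ (fromℕ< x/t<m) * t
      x≡v+[x/t]t = trans (m≡m%n+[m/n]*n (toℕ x) t) (cong₂ (λ a b → a + b * t) x%t≡v (sym (toℕ-fromℕ< x/t<m)))
    %≡-fibre x (no x%t≢v) = trans (count-none (x ≡v+_*t?) (All.universal (λ k x≡v+kt → x%t≢v (begin
                                     toℕ x % t            ≡⟨ cong (_% t) x≡v+kt ⟩
                                     (v + toℕ k * t) % t  ≡⟨ [m+kn]%n≡m%n v (toℕ k) t ⟩
                                     v % t                ≡⟨ m<n⇒m%n≡m v<t ⟩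
                                     v                    ∎)) (allFin m)))
                                  (sym (count-reject (λ x → toℕ x % t ≟ v) x%t≢v))

  count-%≡ : count (λ (x : Fin (t * m)) → toℕ x % t ≟ v) (allFin (t * m)) ≡ m
  count-%≡ = begin
    count (λ x → toℕ x % t ≟ v) (allFin (t * m))
      ≡⟨ count-partition (flip _≡v+_*t?) (λ x → toℕ x % t ≟ v) (allFin m) (allFin (t * m))
                         (All.universal (λ x → %≡-fibre x (toℕ x % t ≟ v)) (allFin (t * m))) ⟩
    sum (map (λ k → count (_≡v+ k *t?) (allFin (t * m))) (allFin m))
      ≡⟨ cong sum (map-cong (λ k → count-unique (_≡v+ k *t?) (toℕ-fromℕ< (v+kt<tm k))
                                                (λ r → toℕ-injective (trans r (sym (toℕ-fromℕ< _))))) (allFin m)) ⟩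
    sum (map (λ _ → 1) (allFin m))
      ≡⟨ sum-map-const 1 (allFin m) ⟩
    length (allFin m) * 1
      ≡⟨ trans (*-identityʳ _) (length-tabulate {n = m} id) ⟩
    m ∎

count-solutions : ∀ {M} .{{_ : NonZero M}} m .{{_ : NonZero m}} {u} → m ∣ M → m ∣ u → u < M →
                  count (λ (x : Fin M) → (m * toℕ x) % M ≟ u) (allFin M) ≡ m
count-solutions m (divides t refl) (divides v refl) vm<tm =
  trans (count-cong _ _ (All.universal (λ x → *-cancelʳ-≡ _ v m ∘ trans (sym (reduce (toℕ x))) , trans (reduce (toℕ x)) ∘ cong (_* m))
                                       (allFin (t * m))))
        (count-%≡ t m (*-cancelʳ-< m v t vm<tm))
  where
  instance
    t-nonZero : NonZero t
    t-nonZero = m*n≢0⇒m≢0 t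
  reduce : ∀ X → (m * X) % (t * m) ≡ (X % t) * m
  reduce X = trans (cong (_% (t * m)) (*-comm m X)) (sym (m%n*o≡m*o%[n*o] X t m))

-- Residues modulo d

module _ {d : ℕ} .{{_ : NonZero d}} where

  residue : ℕ → Fin d
  residue t = fromℕ< (m%n<n t d)

  toℕ-residue : ∀ t → toℕ (residue t) ≡ t % d
  toℕ-residue t = toℕ-fromℕ< (m%n<n t d)

  toℕ%d : (a : Fin d) → toℕ a % d ≡ toℕ a
  toℕ%d a = m<n⇒m%n≡m (toℕ<n a)

  [m%d+n]%d≡[m+n]%d : ∀ m n → (m % d + n) % d ≡ (m + n) % d
  [m%d+n]%d≡[m+n]%d m n = begin
    (m % d + n) % d           ≡⟨ %-distribˡ-+ (m % d) n d ⟩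
    (m % d % d + n % d) % d   ≡⟨ cong (λ t → (t + n % d) % d) (m%n%n≡m%n m d) ⟩
    (m % d + n % d) % d       ≡⟨ %-distribˡ-+ m n d ⟨
    (m + n) % d               ∎

  [m%d*n]%d≡[m*n]%d : ∀ m n → (m % d * n) % d ≡ (m * n) % d
  [m%d*n]%d≡[m*n]%d m n = begin
    (m % d * n) % d           ≡⟨ %-distribˡ-* (m % d) n d ⟩
    (m % d % d * (n % d)) % d ≡⟨ cong (λ t → (t * (n % d)) % d) (m%n%n≡m%n m d) ⟩
    (m % d * (n % d)) % d     ≡⟨ %-distribˡ-* m n d ⟨
    (m * n) % d               ∎

  module _ {_⊗_ : Op₂ ℕ} {e : ℕ} (⊗-isCommutativeMonoid : IsCommutativeMonoid _≡_ _⊗_ e)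
           (%-absorbˡ : ∀ m n → ((m % d) ⊗ n) % d ≡ (m ⊗ n) % d)
           {_⊛_ : Op₂ (Fin d)} (toℕ-⊛ : ∀ x y → toℕ (x ⊛ y) ≡ (toℕ x ⊗ toℕ y) % d) where

    open IsCommutativeMonoid ⊗-isCommutativeMonoid using (assoc; identityˡ; comm)

    private
      %-absorbʳ : ∀ m n → (m ⊗ (n % d)) % d ≡ (m ⊗ n) % d
      %-absorbʳ m n = trans (cong (_% d) (comm m (n % d))) (trans (%-absorbˡ n m) (cong (_% d) (comm n m)))

    residue-isCommutativeMonoid : IsCommutativeMonoid _≡_ _⊛_ (residue e)
    residue-isCommutativeMonoid = isCommutativeMonoidˡ record
      { isSemigroup = record
        { isMagma = record { isEquivalence = ≡.isEquivalence ; ∙-cong = cong₂ _⊛_ }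
        ; assoc   = λ x y z → toℕ-injective (begin
            toℕ ((x ⊛ y) ⊛ z)                     ≡⟨ toℕ-⊛ (x ⊛ y) z ⟩
            (toℕ (x ⊛ y) ⊗ toℕ z) % d             ≡⟨ cong (λ t → (t ⊗ toℕ z) % d) (toℕ-⊛ x y) ⟩
            (((toℕ x ⊗ toℕ y) % d) ⊗ toℕ z) % d   ≡⟨ %-absorbˡ (toℕ x ⊗ toℕ y) (toℕ z) ⟩
            ((toℕ x ⊗ toℕ y) ⊗ toℕ z) % d         ≡⟨ cong (_% d) (assoc (toℕ x) (toℕ y) (toℕ z)) ⟩
            (toℕ x ⊗ (toℕ y ⊗ toℕ z)) % d         ≡⟨ %-absorbʳ (toℕ x) (toℕ y ⊗ toℕ z) ⟨
            (toℕ x ⊗ ((toℕ y ⊗ toℕ z) % d)) % d   ≡⟨ cong (λ t → (toℕ x ⊗ t) % d) (toℕ-⊛ y z) ⟨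
            (toℕ x ⊗ toℕ (y ⊛ z)) % d             ≡⟨ toℕ-⊛ x (y ⊛ z) ⟨
            toℕ (x ⊛ (y ⊛ z))                     ∎)
        }
      ; identityˡ = λ x → toℕ-injective (begin
          toℕ (residue e ⊛ x)             ≡⟨ toℕ-⊛ (residue e) x ⟩
          (toℕ (residue e) ⊗ toℕ x) % d   ≡⟨ cong (λ t → (t ⊗ toℕ x) % d) (toℕ-residue e) ⟩
          ((e % d) ⊗ toℕ x) % d           ≡⟨ %-absorbˡ e (toℕ x) ⟩
          (e ⊗ toℕ x) % d                 ≡⟨ cong (_% d) (identityˡ (toℕ x)) ⟩
          toℕ x % d                       ≡⟨ toℕ%d x ⟩
          toℕ x                           ∎)
      ; comm = λ x y → toℕ-injective (trans (toℕ-⊛ x y) (trans (cong (_% d) (comm (toℕ x) (toℕ y))) (sym (toℕ-⊛ y x))))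
      }

toℕ-addMod : ∀ {d} .{{_ : NonZero d}} (x y : Fin d) → toℕ (addMod x y) ≡ (toℕ x + toℕ y) % d
toℕ-addMod {suc _} x y = toℕ-residue (toℕ x + toℕ y)

toℕ-mulMod : ∀ {d} .{{_ : NonZero d}} (x y : Fin d) → toℕ (mulMod x y) ≡ (toℕ x * toℕ y) % d
toℕ-mulMod {suc _} x y = toℕ-residue (toℕ x * toℕ y)

NegR⇔ : ∀ {d} .{{_ : NonZero d}} {x y : Fin d} → 2 ∣ d → NegR x y ⇔ (toℕ y ≡ (toℕ x + d / 2) % d)
NegR⇔ {suc _} 2∣d = mk⇔ proj₂ (2∣d ,_)

module _ (d : ℕ) .{{_ : NonZero d}} where

  negMod : Fin d → Fin d
  negMod x = residue (d ∸ toℕ x)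

  addMod-inverseʳ : ∀ x → addMod x (negMod x) ≡ residue 0
  addMod-inverseʳ x = toℕ-injective (begin
    toℕ (addMod x (negMod x))            ≡⟨ toℕ-addMod x (negMod x) ⟩
    (toℕ x + toℕ (negMod x)) % d         ≡⟨ cong (λ t → (toℕ x + t) % d) (toℕ-residue (d ∸ toℕ x)) ⟩
    (toℕ x + (d ∸ toℕ x) % d) % d        ≡⟨ cong (_% d) (+-comm (toℕ x) _) ⟩
    ((d ∸ toℕ x) % d + toℕ x) % d        ≡⟨ [m%d+n]%d≡[m+n]%d (d ∸ toℕ x) (toℕ x) ⟩
    (d ∸ toℕ x + toℕ x) % d              ≡⟨ cong (_% d) (m∸n+n≡m (<⇒≤ (toℕ<n x))) ⟩
    d % d                                ≡⟨ n%n≡0 d ⟩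
    0                                    ≡⟨ m<n⇒m%n≡m (>-nonZero⁻¹ d) ⟨
    0 % d                                ≡⟨ toℕ-residue 0 ⟨
    toℕ (residue 0)                      ∎)

  +-mod-abelianGroup : AbelianGroup 0ℓ 0ℓ
  +-mod-abelianGroup = record
    { isAbelianGroup = record
      { isGroup = record
        { isMonoid = isMonoid
        ; inverse  = (λ x → trans (comm (negMod x) x) (addMod-inverseʳ x)) , addMod-inverseʳ
        ; ⁻¹-cong  = cong negMod
        }
      ; comm = comm
      }
    }
    where
    open IsCommutativeMonoid
      (residue-isCommutativeMonoid +-0-isCommutativeMonoid [m%d+n]%d≡[m+n]%d toℕ-addMod)
      using (isMonoid; comm)

  *-mod-commutativeMonoid : CommutativeMonoid 0ℓ 0ℓ
  *-mod-commutativeMonoid = record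
    { isCommutativeMonoid = residue-isCommutativeMonoid *-1-isCommutativeMonoid [m%d*n]%d≡[m*n]%d toℕ-mulMod }

-- The unit group of ℤ/qℤ

module Units (q : ℕ) .{{_ : NonZero q}} where

  open CommutativeMonoid (*-mod-commutativeMonoid q) public
    using (_∙_; ε; assoc; comm; identityˡ; identityʳ; monoid; commutativeSemigroup)
  open CommutativeSemigroupProperties commutativeSemigroup public using (interchange)
  open import Algebra.Properties.CommutativeMonoid.Mult (*-mod-commutativeMonoid q)
    using (×-homo-+; ×-assocˡ; ×-distrib-+) renaming (_×_ to _×ᵐ_)
  open import Algebra.Properties.Monoid monoid public using (cancelˡ; cancelʳ)

  infixr 8 _^_
  _^_ : Fin q → ℕ → Fin q
  a ^ k = k ×ᵐ a

  ^-+ : ∀ a j k → a ^ (j + k) ≡ a ^ j ∙ a ^ k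
  ^-+ a = ×-homo-+ a

  ^-* : ∀ a j k → a ^ (j * k) ≡ (a ^ j) ^ k
  ^-* a j k = trans (cong (a ^_) (*-comm j k)) (sym (×-assocˡ a k j))

  ^-∙ : ∀ a b k → (a ∙ b) ^ k ≡ a ^ k ∙ b ^ k
  ^-∙ a b k = ×-distrib-+ a b k

  ε^ : ∀ k → ε ^ k ≡ ε
  ε^ zero    = refl
  ε^ (suc k) = trans (identityˡ (ε ^ k)) (ε^ k)

  toℕ-ε : toℕ ε ≡ 1 % q
  toℕ-ε = toℕ-residue 1

  Invertible : Fin q → Set
  Invertible a = ∃[ b ] a ∙ b ≡ ε

  Unit⇒Invertible : ∀ {a} → Unit q a → Invertible a
  Unit⇒Invertible {a} u with mod-inverse {toℕ a} {q} u
  ... | x , ax≡1 = residue x , toℕ-injective (begin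
    toℕ (a ∙ residue x)            ≡⟨ toℕ-mulMod a (residue x) ⟩
    (toℕ a * toℕ (residue x)) % q  ≡⟨ cong (λ t → (toℕ a * t) % q) (toℕ-residue x) ⟩
    (toℕ a * (x % q)) % q          ≡⟨ cong (_% q) (*-comm (toℕ a) (x % q)) ⟩
    (x % q * toℕ a) % q            ≡⟨ [m%d*n]%d≡[m*n]%d x (toℕ a) ⟩
    (x * toℕ a) % q                ≡⟨ cong (_% q) (*-comm x (toℕ a)) ⟩
    (toℕ a * x) % q                ≡⟨ ax≡1 ⟩
    1 % q                          ≡⟨ toℕ-ε ⟨
    toℕ ε                          ∎)

  Invertible⇒Unit : ∀ {a} → Invertible a → Unit q a
  Invertible⇒Unit {a} (b , ab≡ε) = ∣1⇒≡1 (subst (g ∣_) (sym (m≡m%n+[m/n]*n 1 q)) g∣1%q+[1/q]*q)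
    where
    g = gcd (toℕ a) q
    g∣[1/q]*q : g ∣ (1 / q) * q
    g∣[1/q]*q = ∣n⇒∣m*n (1 / q) (gcd[m,n]∣n (toℕ a) q)
    g∣1%q : g ∣ 1 % q
    g∣1%q = subst (g ∣_) (trans (sym (toℕ-mulMod a b)) (trans (cong toℕ ab≡ε) toℕ-ε))
                  (%-presˡ-∣ (∣m⇒∣m*n (toℕ b) (gcd[m,n]∣m (toℕ a) q)) (gcd[m,n]∣n (toℕ a) q))
    g∣1%q+[1/q]*q : g ∣ 1 % q + (1 / q) * q
    g∣1%q+[1/q]*q = ∣m∣n⇒∣m+n g∣1%q g∣[1/q]*q

  Invertible? : Decidable Invertible
  Invertible? a = any? (λ b → a ∙ b ≟ᶠ ε)

  -- Junk value ε on non-units.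
  _⁻¹ : Fin q → Fin q
  a ⁻¹ with Invertible? a
  ... | yes (b , _) = b
  ... | no _        = ε

  module _ {a : Fin q} (u : Unit q a) where

    inverseʳ : a ∙ a ⁻¹ ≡ ε
    inverseʳ with Invertible? a
    ... | yes (_ , ab≡ε) = ab≡ε
    ... | no ¬invertible = contradiction (Unit⇒Invertible u) ¬invertible

    inverseˡ : a ⁻¹ ∙ a ≡ ε
    inverseˡ = trans (comm (a ⁻¹) a) inverseʳ

    ∙-cancelˡ : ∀ {x y} → a ∙ x ≡ a ∙ y → x ≡ y
    ∙-cancelˡ {x} {y} ax≡ay = begin
      x               ≡⟨ cancelˡ inverseˡ x ⟨
      a ⁻¹ ∙ (a ∙ x)  ≡⟨ cong (a ⁻¹ ∙_) ax≡ay ⟩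
      a ⁻¹ ∙ (a ∙ y)  ≡⟨ cancelˡ inverseˡ y ⟩
      y               ∎

    ⁻¹-unique : ∀ {b} → a ∙ b ≡ ε → a ⁻¹ ≡ b
    ⁻¹-unique ab≡ε = ∙-cancelˡ (trans inverseʳ (sym ab≡ε))

    Unit-⁻¹ : Unit q (a ⁻¹)
    Unit-⁻¹ = Invertible⇒Unit (a , inverseˡ)

  Unit-ε : Unit q ε
  Unit-ε = Invertible⇒Unit (ε , identityˡ ε)

  Unit-∙ : ∀ {a b} → Unit q a → Unit q b → Unit q (a ∙ b)
  Unit-∙ {a} {b} ua ub = Invertible⇒Unit (a ⁻¹ ∙ b ⁻¹ , (begin
    (a ∙ b) ∙ (a ⁻¹ ∙ b ⁻¹)  ≡⟨ interchange a b (a ⁻¹) (b ⁻¹) ⟩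
    (a ∙ a ⁻¹) ∙ (b ∙ b ⁻¹)  ≡⟨ cong₂ _∙_ (inverseʳ ua) (inverseʳ ub) ⟩
    ε ∙ ε                    ≡⟨ identityˡ ε ⟩
    ε                        ∎))

  Unit-∙ˡ : ∀ {a b} → Unit q (a ∙ b) → Unit q a
  Unit-∙ˡ {a} {b} u = Invertible⇒Unit (b ∙ (a ∙ b) ⁻¹ , trans (sym (assoc a b _)) (inverseʳ u))

  Unit-∙ʳ : ∀ {a b} → Unit q (a ∙ b) → Unit q b
  Unit-∙ʳ {a} {b} u = Unit-∙ˡ (subst (Unit q) (comm a b) u)

  Unit-^ : ∀ {a} k → Unit q a → Unit q (a ^ k)
  Unit-^ zero    u = Unit-ε
  Unit-^ (suc k) u = Unit-∙ u (Unit-^ k u)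

  ratio-square : ∀ {a c} → Unit q c → a ∙ a ≡ c ∙ c → (a ∙ c ⁻¹) ∙ (a ∙ c ⁻¹) ≡ ε
  ratio-square {a} {c} uc a²≡c² = begin
    (a ∙ c ⁻¹) ∙ (a ∙ c ⁻¹)   ≡⟨ interchange a (c ⁻¹) a (c ⁻¹) ⟩
    (a ∙ a) ∙ (c ⁻¹ ∙ c ⁻¹)   ≡⟨ cong (_∙ (c ⁻¹ ∙ c ⁻¹)) a²≡c² ⟩
    (c ∙ c) ∙ (c ⁻¹ ∙ c ⁻¹)   ≡⟨ interchange c c (c ⁻¹) (c ⁻¹) ⟩
    (c ∙ c ⁻¹) ∙ (c ∙ c ⁻¹)   ≡⟨ cong₂ _∙_ (inverseʳ uc) (inverseʳ uc) ⟩
    ε ∙ ε                     ≡⟨ identityˡ ε ⟩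
    ε                         ∎

  ^-%-≡ : ∀ {a b} m .{{_ : NonZero m}} j → a ^ m ∙ b ≡ ε → a ^ (j % m) ≡ a ^ j ∙ b ^ (j / m)
  ^-%-≡ {a} {b} m j aᵐb≡ε = begin
    a ^ (j % m)                                 ≡⟨ identityʳ _ ⟨
    a ^ (j % m) ∙ ε                             ≡⟨ cong (a ^ (j % m) ∙_) (trans (sym (ε^ (j / m))) (cong (_^ (j / m)) (sym aᵐb≡ε))) ⟩
    a ^ (j % m) ∙ (a ^ m ∙ b) ^ (j / m)         ≡⟨ cong (a ^ (j % m) ∙_) (^-∙ (a ^ m) b (j / m)) ⟩
    a ^ (j % m) ∙ ((a ^ m) ^ (j / m) ∙ b ^ (j / m)) ≡⟨ assoc _ _ _ ⟨
    (a ^ (j % m) ∙ (a ^ m) ^ (j / m)) ∙ b ^ (j / m) ≡⟨ cong (λ t → (a ^ (j % m) ∙ t) ∙ b ^ (j / m)) (^-* a m (j / m)) ⟨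
    (a ^ (j % m) ∙ a ^ (m * (j / m))) ∙ b ^ (j / m) ≡⟨ cong (_∙ b ^ (j / m)) (^-+ a (j % m) (m * (j / m))) ⟨
    a ^ (j % m + m * (j / m)) ∙ b ^ (j / m)     ≡⟨ cong (λ t → a ^ t ∙ b ^ (j / m)) (trans (cong (j % m +_) (*-comm m (j / m))) (sym (m≡m%n+[m/n]*n j m))) ⟩
    a ^ j ∙ b ^ (j / m)                         ∎

  record Subgroup : Set₁ where
    field
      member  : Pred (Fin q) 0ℓ
      member? : Decidable member
      ε∈      : member ε
      ∙∈      : ∀ {x y} → member x → member y → member (x ∙ y)
      ∈⇒Unit  : ∀ {x} → member x → Unit q x

  open Subgroup public using (member?; ε∈; ∙∈; ∈⇒Unit)

  infix 4 _∈_ _∉_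
  _∈_ _∉_ : Fin q → Subgroup → Set
  x ∈ S = Subgroup.member S x
  x ∉ S = ¬ x ∈ S

  size : Subgroup → ℕ
  size S = count (member? S) (allFin q)

  order : ∀ g → Unit q g → ∃[ k ] g ^ suc k ≡ ε
  order g ug with pigeonhole (n<1+n q) (λ i → g ^ toℕ i)
  ... | i , j , i<j , gⁱ≡gʲ = j′ ∸ suc (toℕ i) , ∙-cancelˡ (Unit-^ (toℕ i) ug) (begin
    g ^ toℕ i ∙ g ^ suc (j′ ∸ suc (toℕ i)) ≡⟨ ^-+ g (toℕ i) _ ⟨
    g ^ (toℕ i + suc (j′ ∸ suc (toℕ i)))  ≡⟨ cong (g ^_) (trans (+-suc (toℕ i) _) (m+[n∸m]≡n i<j)) ⟩
    g ^ j′                                 ≡⟨ gⁱ≡gʲ ⟨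
    g ^ toℕ i                              ≡⟨ identityʳ _ ⟨
    g ^ toℕ i ∙ ε                          ∎)
    where j′ = toℕ j

  ^∈ : ∀ S {x} k → x ∈ S → x ^ k ∈ S
  ^∈ S zero    x∈S = ε∈ S
  ^∈ S (suc k) x∈S = ∙∈ S x∈S (^∈ S k x∈S)

  ⁻¹∈ : ∀ S {x} → x ∈ S → x ⁻¹ ∈ S
  ⁻¹∈ S {x} x∈S with order x (∈⇒Unit S x∈S)
  ... | k , xˢᵏ≡ε = subst (_∈ S) (sym (⁻¹-unique (∈⇒Unit S x∈S) xˢᵏ≡ε)) (^∈ S k x∈S)

  count-∙-invariant : ∀ {P : Pred (Fin q) 0ℓ} (P? : Decidable P) {a} → Unit q a →
                      count (λ x → P? (x ∙ a)) (allFin q) ≡ count P? (allFin q)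
  count-∙-invariant {P} P? {a} ua = begin
    count (λ x → P? (x ∙ a)) (allFin q)                  ≡⟨ count-partition R? (λ x → P? (x ∙ a)) (allFin q) (allFin q)
                                                              (All.universal image (allFin q)) ⟩
    sum (map (λ y → count (R? y) (allFin q)) (allFin q)) ≡⟨ cong sum (map-cong preimage (allFin q)) ⟩
    sum (map (λ y → count P? [ y ]) (allFin q))          ≡⟨ count≡sum P? (allFin q) ⟨
    count P? (allFin q)                                  ∎
    where
    R : Fin q → Pred (Fin q) 0ℓ
    R y x = x ∙ a ≡ y × P y
    R? : ∀ y → Decidable (R y)
    R? y x = (x ∙ a ≟ᶠ y) ×-dec P? y
    image : ∀ x → count (λ y → R? y x) (allFin q) ≡ count (λ x → P? (x ∙ a)) [ x ]
    image x with P? (x ∙ a)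
    ... | yes p = count-unique (λ y → R? y x) (refl , p) (sym ∘ proj₁)
    ... | no ¬p = count-none (λ y → R? y x) (All.universal (λ { y (refl , p) → ¬p p }) (allFin q))
    preimage : ∀ y → count (R? y) (allFin q) ≡ count P? [ y ]
    preimage y = by-cases (P? y)
      where
      by-cases : Dec (P y) → count (R? y) (allFin q) ≡ count P? [ y ]
      by-cases (yes p) = trans (count-unique (R? y) (cancelʳ (inverseˡ ua) y , p) (λ { (refl , _) → sym (cancelʳ (inverseʳ ua) _) }))
                               (sym (count-accept P? p))
      by-cases (no ¬p) = trans (count-none (R? y) (All.universal (λ _ → ¬p ∘ proj₂) (allFin q))) (sym (count-reject P? ¬p))

  -- ⟨S, g⟩ = ⋃_{j<m} S gʲ, where gᵐ is the least positive power of g lying in S.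
  module Extension (S : Subgroup) (g : Fin q) (ug : Unit q g) where

    h : Fin q
    h = g ⁻¹

    -- Abstract, so that m does not unfold into the search during unification.
    abstract
      least-exponent : ∃[ k ] g ^ suc k ∈ S × (∀ {j} → j < k → g ^ suc j ∉ S)
      least-exponent = least (λ j → member? S (g ^ suc j)) {proj₁ (order g ug)} (subst (_∈ S) (sym (proj₂ (order g ug))) (ε∈ S))

    m : ℕ
    m = suc (proj₁ least-exponent)

    gᵐ∈S : g ^ m ∈ S
    gᵐ∈S = proj₁ (proj₂ least-exponent)

    gʲ∉S : ∀ {j} → 0 < j → j < m → g ^ j ∉ S
    gʲ∉S {suc j} _ (s≤s j<m) = proj₂ (proj₂ least-exponent) j<m

    gʲhʲ≡ε : ∀ j → g ^ j ∙ h ^ j ≡ ε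
    gʲhʲ≡ε j = trans (sym (^-∙ g h j)) (trans (cong (_^ j) (inverseʳ ug)) (ε^ j))

    hʲgʲ≡ε : ∀ j → h ^ j ∙ g ^ j ≡ ε
    hʲgʲ≡ε j = trans (comm (h ^ j) (g ^ j)) (gʲhʲ≡ε j)

    hᵐ∈S : h ^ m ∈ S
    hᵐ∈S = subst (_∈ S) (⁻¹-unique (Unit-^ m ug) (gʲhʲ≡ε m)) (⁻¹∈ S gᵐ∈S)

    gʳ∈S⇒r≡0 : ∀ {r} → r < m → g ^ r ∈ S → r ≡ 0
    gʳ∈S⇒r≡0 {zero}  _   _      = refl
    gʳ∈S⇒r≡0 {suc r} r<m gʳ∈S = contradiction gʳ∈S (gʲ∉S (s≤s z≤n) r<m)

    gᵈ∈S⇒m∣d : ∀ {d} → g ^ d ∈ S → m ∣ d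
    gᵈ∈S⇒m∣d {d} gᵈ∈S = m%n≡0⇒n∣m d m (gʳ∈S⇒r≡0 (m%n<n d m) g^[d%m]∈S)
      where
      g^[d%m]∈S : g ^ (d % m) ∈ S
      g^[d%m]∈S = subst (_∈ S) (sym (^-%-≡ m d (gʲhʲ≡ε m))) (∙∈ S gᵈ∈S (^∈ S (d / m) hᵐ∈S))

    hᵈ∈S⇒m∣d : ∀ {d} → h ^ d ∈ S → m ∣ d
    hᵈ∈S⇒m∣d {d} hᵈ∈S = gᵈ∈S⇒m∣d (subst (_∈ S) (⁻¹-unique (Unit-^ d (Unit-⁻¹ ug)) (hʲgʲ≡ε d)) (⁻¹∈ S hᵈ∈S))

    m≡2 : g ∉ S → g ∙ g ∈ S → m ≡ 2
    m≡2 g∉S g²∈S = ≤-antisym (∣⇒≤ (gᵈ∈S⇒m∣d (subst (_∈ S) (cong (g ∙_) (sym (identityʳ g))) g²∈S))) 2≤m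
      where
      2≤m : 2 ≤ m
      2≤m = ≤∧≢⇒< (s≤s z≤n) (λ 1≡m → g∉S (subst (_∈ S) (trans (cong (g ^_) (sym 1≡m)) (identityʳ g)) gᵐ∈S))

    hᵈ∈S : ∀ {y} i d → y ∙ h ^ i ∈ S → y ∙ h ^ (i + d) ∈ S → h ^ d ∈ S
    hᵈ∈S {y} i d p p′ = subst (_∈ S) (cancelˡ (inverseˡ (∈⇒Unit S p)) (h ^ d)) (∙∈ S (⁻¹∈ S p) (subst (_∈ S) (begin
      y ∙ h ^ (i + d)        ≡⟨ cong (y ∙_) (^-+ h i d) ⟩
      y ∙ (h ^ i ∙ h ^ d)    ≡⟨ assoc y _ _ ⟨
      (y ∙ h ^ i) ∙ h ^ d    ∎) p′))

    exponent-unique-≤ : ∀ {y i j} → i ≤ j → j < m → y ∙ h ^ i ∈ S → y ∙ h ^ j ∈ S → i ≡ j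
    exponent-unique-≤ {y} {i} {j} i≤j j<m p p′ = begin
      i             ≡⟨ +-identityʳ i ⟨
      i + 0         ≡⟨ cong (i +_) j∸i≡0 ⟨
      i + (j ∸ i)   ≡⟨ m+[n∸m]≡n i≤j ⟩
      j             ∎
      where
      j∸i≡0 : j ∸ i ≡ 0
      j∸i≡0 = m∣n⇒n<m⇒n≡0 (hᵈ∈S⇒m∣d (hᵈ∈S i (j ∸ i) p (subst (λ k → y ∙ h ^ k ∈ S) (sym (m+[n∸m]≡n i≤j)) p′)))
                          (≤-<-trans (m∸n≤m j i) j<m)

    exponent-unique : ∀ {y i j} → i < m → j < m → y ∙ h ^ i ∈ S → y ∙ h ^ j ∈ S → i ≡ j
    exponent-unique {i = i} {j} i<m j<m p p′ with ≤-total i j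
    ... | inj₁ i≤j = exponent-unique-≤ i≤j j<m p p′
    ... | inj₂ j≤i = sym (exponent-unique-≤ j≤i i<m p′ p)

    Member : Pred (Fin q) 0ℓ
    Member y = ∃[ j ] y ∙ h ^ toℕ {m} j ∈ S

    Member? : Decidable Member
    Member? y = any? (λ j → member? S (y ∙ h ^ toℕ j))

    -- Any exponent j may be reduced modulo m since hᵐ ∈ S.
    member : ∀ {y} j → y ∙ h ^ j ∈ S → Member y
    member {y} j p = residue {m} j , subst (_∈ S) (begin
      (y ∙ h ^ j) ∙ (g ^ m) ^ (j / m)  ≡⟨ assoc y _ _ ⟩
      y ∙ (h ^ j ∙ (g ^ m) ^ (j / m))  ≡⟨ cong (y ∙_) (^-%-≡ m j (hʲgʲ≡ε m)) ⟨
      y ∙ h ^ (j % m)                  ≡⟨ cong (λ k → y ∙ h ^ k) (toℕ-residue {m} j) ⟨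
      y ∙ h ^ toℕ (residue {m} j)      ∎) (∙∈ S p (^∈ S (j / m) gᵐ∈S))

    ∈⇒Member : ∀ {x} → x ∈ S → Member x
    ∈⇒Member {x} x∈S = member 0 (subst (_∈ S) (sym (identityʳ x)) x∈S)

    g-Member : Member g
    g-Member = member 1 (subst (_∈ S) (sym (trans (cong (g ∙_) (identityʳ h)) (inverseʳ ug))) (ε∈ S))

    ∙-h^-+ : ∀ y z i j → (y ∙ z) ∙ h ^ (i + j) ≡ (y ∙ h ^ i) ∙ (z ∙ h ^ j)
    ∙-h^-+ y z i j = trans (cong ((y ∙ z) ∙_) (^-+ h i j)) (interchange y z (h ^ i) (h ^ j))

    extension : Subgroup
    extension = record
      { member  = Member
      ; member? = Member?
      ; ε∈      = ∈⇒Member (ε∈ S)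
      ; ∙∈      = λ { {x} {y} (i , p) (j , p′) → member (toℕ i + toℕ j) (subst (_∈ S) (sym (∙-h^-+ x y (toℕ i) (toℕ j))) (∙∈ S p p′)) }
      ; ∈⇒Unit  = λ { {y} (j , p) → subst (Unit q) (cancelʳ (hʲgʲ≡ε (toℕ j)) y) (Unit-∙ (∈⇒Unit S p) (Unit-^ (toℕ j) ug)) }
      }

    size-extension : size extension ≡ m * size S
    size-extension = begin
      count Member? (allFin q)                                 ≡⟨ count-partition R? Member? (allFin m) (allFin q) (All.universal fibre (allFin q)) ⟩
      sum (map (λ j → count (R? j) (allFin q)) (allFin m))
        ≡⟨ cong sum (map-cong (λ j → count-∙-invariant (member? S) (Unit-^ (toℕ j) (Unit-⁻¹ ug))) (allFin m)) ⟩
      sum (map (λ _ → size S) (allFin m))                      ≡⟨ sum-map-const (size S) (allFin m) ⟩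
      length (allFin m) * size S                               ≡⟨ cong (_* size S) (length-tabulate {n = m} (λ j → j)) ⟩
      m * size S                                               ∎
      where
      R? : ∀ (j : Fin m) → Decidable (λ y → y ∙ h ^ toℕ j ∈ S)
      R? j y = member? S (y ∙ h ^ toℕ j)
      fibre : ∀ y → count (λ j → R? j y) (allFin m) ≡ count Member? [ y ]
      fibre y = by-cases (Member? y)
        where
        by-cases : Dec (Member y) → count (λ j → R? j y) (allFin m) ≡ count Member? [ y ]
        by-cases (yes y∈@(j , p)) = trans (count-unique (λ j → R? j y) p (λ p′ → toℕ-injective (exponent-unique (toℕ<n _) (toℕ<n j) p′ p)))
                                          (sym (count-accept Member? y∈))
        by-cases (no y∉)          = trans (count-none (λ j → R? j y) (All.universal (λ j p → y∉ (j , p)) (allFin m)))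
                                          (sym (count-reject Member? y∉))

  open Extension using (extension; size-extension; ∈⇒Member; g-Member)

  trivial : Subgroup
  trivial = record
    { member  = _≡ ε
    ; member? = _≟ᶠ ε
    ; ε∈      = refl
    ; ∙∈      = λ { refl refl → identityˡ ε }
    ; ∈⇒Unit  = λ { refl → Unit-ε }
    }

  subgroup-induction : (P : Subgroup → Set) →
                       (∀ S → (∀ {x} → Unit q x → x ∈ S) → P S) →
                       (∀ S g (ug : Unit q g) → P (extension S g ug) → P S) →
                       ∀ S → P S
  subgroup-induction P base step S = go (allFin q) S (λ {x} _ → inj₂ (∈-allFin x))
    where
    go : ∀ L S → (∀ {x} → Unit q x → x ∈ S ⊎ x ∈ˡ L) → P S
    go []      S covered = base S (λ ux → [ id , (λ ()) ]′ (covered ux))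
    go (g ∷ L) S covered = by-unit (Unit? q g)
      where
      by-unit : Dec (Unit q g) → P S
      by-unit (yes ug) = step S g ug (go L (extension S g ug) (extend ∘ covered))
        where
        extend : ∀ {x} → x ∈ S ⊎ x ∈ˡ g ∷ L → x ∈ extension S g ug ⊎ x ∈ˡ L
        extend (inj₁ x∈S)         = inj₁ (∈⇒Member S g ug x∈S)
        extend (inj₂ (here refl)) = inj₁ (g-Member S g ug)
        extend (inj₂ (there x∈L)) = inj₂ x∈L
      by-unit (no ¬ug) = go L S (λ ux → skip ux (covered ux))
        where
        skip : ∀ {x} → Unit q x → x ∈ S ⊎ x ∈ˡ g ∷ L → x ∈ S ⊎ x ∈ˡ L
        skip _  (inj₁ x∈S)         = inj₁ x∈S
        skip ux (inj₂ (here refl)) = contradiction ux ¬ug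
        skip _  (inj₂ (there x∈L)) = inj₂ x∈L

  size-full : ∀ S → (∀ {x} → Unit q x → x ∈ S) → size S ≡ φ q
  size-full S full = count-cong (member? S) (Unit? q) (All.universal (λ _ → ∈⇒Unit S , full) (allFin q))

  size∣φ : ∀ S → size S ∣ φ q
  size∣φ = subgroup-induction (λ S → size S ∣ φ q)
    (λ S full → ∣-reflexive (size-full S full))
    (λ S g ug ext∣φ → ∣-trans (n∣m*n (Extension.m S g ug)) (subst (_∣ φ q) (size-extension S g ug) ext∣φ))

  ^φ≡ε : ∀ g → Unit q g → g ^ φ q ≡ ε
  ^φ≡ε g ug with size∣φ (extension trivial g ug)
  ... | divides t φ≡t*size = begin
    g ^ φ q        ≡⟨ cong (g ^_) (trans φ≡t*size (cong (t *_) (trans (size-extension trivial g ug) (trans (cong (m *_) (count-≟-allFin ε)) (*-identityʳ m))))) ⟩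
    g ^ (t * m)    ≡⟨ cong (g ^_) (*-comm t m) ⟩
    g ^ (m * t)    ≡⟨ ^-* g m t ⟩
    (g ^ m) ^ t    ≡⟨ cong (_^ t) (Extension.gᵐ∈S trivial g ug) ⟩
    ε ^ t          ≡⟨ ε^ t ⟩
    ε              ∎
    where m = Extension.m trivial g ug

-- Dirichlet characters

module Characters (q : ℕ) .{{_ : NonZero q}} where

  open Units q

  N : ℕ
  N = φ q

  instance
    N-nonZero : NonZero N
    N-nonZero = >-nonZero (filter-some (Unit? q) (Any.map (λ { refl → Unit-ε }) (∈-allFin ε)))

  open AbelianGroup (+-mod-abelianGroup N) public using ()
    renaming (_∙_ to _⊕_; ε to 0ᴺ; assoc to ⊕-assoc; comm to ⊕-comm; identityˡ to ⊕-identityˡ;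
              identityʳ to ⊕-identityʳ; commutativeMonoid to ⊕-commutativeMonoid; group to ⊕-group)
  open Algebra.Properties.Group ⊕-group using (∙-cancelʳ)
  open import Algebra.Properties.CommutativeMonoid.Mult ⊕-commutativeMonoid public
    using (×-homo-+; ×-assocˡ; ×-distrib-+) renaming (_×_ to _·_)
  open CommutativeSemigroupProperties (CommutativeMonoid.commutativeSemigroup ⊕-commutativeMonoid)
    using () renaming (interchange to ⊕-interchange)

  toℕ-0ᴺ : toℕ 0ᴺ ≡ 0
  toℕ-0ᴺ = trans (toℕ-residue 0) (m<n⇒m%n≡m (>-nonZero⁻¹ N))

  ·0ᴺ : ∀ k → k · 0ᴺ ≡ 0ᴺ
  ·0ᴺ zero    = refl
  ·0ᴺ (suc k) = trans (⊕-identityˡ (k · 0ᴺ)) (·0ᴺ k)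

  toℕ-· : ∀ k x → toℕ (k · x) ≡ (k * toℕ x) % N
  toℕ-· zero    x = toℕ-residue 0
  toℕ-· (suc k) x = begin
    toℕ (x ⊕ k · x)                     ≡⟨ toℕ-addMod x (k · x) ⟩
    (toℕ x + toℕ (k · x)) % N           ≡⟨ cong (λ t → (toℕ x + t) % N) (toℕ-· k x) ⟩
    (toℕ x + (k * toℕ x) % N) % N       ≡⟨ cong (_% N) (+-comm (toℕ x) _) ⟩
    ((k * toℕ x) % N + toℕ x) % N       ≡⟨ [m%d+n]%d≡[m+n]%d {N} (k * toℕ x) (toℕ x) ⟩
    (k * toℕ x + toℕ x) % N             ≡⟨ cong (_% N) (+-comm (k * toℕ x) (toℕ x)) ⟩
    (suc k * toℕ x) % N                 ∎

  idem⇒0ᴺ : ∀ {v} → v ⊕ v ≡ v → v ≡ 0ᴺ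
  idem⇒0ᴺ {v} v⊕v≡v = ∙-cancelʳ v v 0ᴺ (trans v⊕v≡v (sym (⊕-identityˡ v)))

  module Character (χ : Fun q) (isChar : IsChar q χ) where

    χ-∙ : ∀ x y → lookup χ (x ∙ y) ≡ lookup χ x ·v lookup χ y
    χ-∙ = proj₁ isChar

    χ-unit : ∀ x → Unit q x → ∃[ v ] lookup χ x ≡ just v
    χ-unit x ux with lookup χ x in χx≡v
    ... | just v  = v , refl
    ... | nothing = contradiction ux (proj₁ (proj₂ isChar x) χx≡v)

    χ-nonunit : ∀ {x} → ¬ Unit q x → lookup χ x ≡ nothing
    χ-nonunit {x} = proj₂ (proj₂ isChar x)

    χ-ε : lookup χ ε ≡ just 0ᴺ
    χ-ε with χ-unit ε Unit-ε
    ... | v , χε≡v = trans χε≡v (cong just (idem⇒0ᴺ (just-injective (begin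
      just (v ⊕ v)             ≡⟨ cong₂ _·v_ χε≡v χε≡v ⟨
      lookup χ ε ·v lookup χ ε ≡⟨ χ-∙ ε ε ⟨
      lookup χ (ε ∙ ε)         ≡⟨ cong (lookup χ) (identityˡ ε) ⟩
      lookup χ ε               ≡⟨ χε≡v ⟩
      just v                   ∎))))

    χ-^ : ∀ {g v} → lookup χ g ≡ just v → ∀ k → lookup χ (g ^ k) ≡ just (k · v)
    χ-^ χg≡v zero    = χ-ε
    χ-^ {g} χg≡v (suc k) = trans (χ-∙ g (g ^ k)) (cong₂ _·v_ χg≡v (χ-^ χg≡v k))

  -- A character of S, written additively: ψ x is the exponent of ζ = e^(2πi/N).
  record Hom (S : Subgroup) (ψ : Fin q → Fin N) : Set where
    field
      homo : ∀ {x y} → x ∈ S → y ∈ S → ψ (x ∙ y) ≡ ψ x ⊕ ψ y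

  open Hom public

  module _ {S ψ} (hom : Hom S ψ) where

    hom-ε : ψ ε ≡ 0ᴺ
    hom-ε = idem⇒0ᴺ (trans (sym (homo hom (ε∈ S) (ε∈ S))) (cong ψ (identityˡ ε)))

    hom-^ : ∀ {x} k → x ∈ S → ψ (x ^ k) ≡ k · ψ x
    hom-^ zero    x∈S = hom-ε
    hom-^ (suc k) x∈S = trans (homo hom x∈S (^∈ S k x∈S)) (cong (ψ _ ⊕_) (hom-^ k x∈S))

  Extends : Subgroup → (Fin q → Fin N) → Pred (Fun q) 0ℓ
  Extends S ψ χ = ∀ x → x ∈ S → lookup χ x ≡ just (ψ x)

  Extends? : ∀ S ψ → Decidable (Extends S ψ)
  Extends? S ψ χ = all? (λ x → member? S x →-dec lookup χ x ≟v just (ψ x))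

  Chars-isChar : All (IsChar q) (Chars q)
  Chars-isChar = all-filter (IsChar? q) (allVecs (allVals N) q)

  extensions : Subgroup → (Fin q → Fin N) → ℕ
  extensions S ψ = count (Extends? S ψ) (Chars q)

  module Full {S ψ} (hom : Hom S ψ) (full : ∀ {x} → Unit q x → x ∈ S) where

    value : ∀ y → Dec (Unit q y) → Val N
    value y (yes _) = just (ψ y)
    value y (no _)  = nothing

    table : Fun q
    table = tabulate (λ y → value y (Unit? q y))

    lookup-table : ∀ y → lookup table y ≡ value y (Unit? q y)
    lookup-table y = lookup∘tabulate (λ y → value y (Unit? q y)) y

    value-∙ : ∀ a b (ua? : Dec (Unit q a)) (ub? : Dec (Unit q b)) (uab? : Dec (Unit q (a ∙ b))) →
              value (a ∙ b) uab? ≡ value a ua? ·v value b ub?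
    value-∙ a b (yes ua) (yes ub) (yes _)    = cong just (homo hom (full ua) (full ub))
    value-∙ a b (yes ua) (yes ub) (no ¬uab)  = contradiction (Unit-∙ ua ub) ¬uab
    value-∙ a b (no ¬ua) _        (yes uab)  = contradiction (Unit-∙ˡ uab) ¬ua
    value-∙ a b (yes _)  (no ¬ub) (yes uab)  = contradiction (Unit-∙ʳ uab) ¬ub
    value-∙ a b (no _)   _        (no _)     = refl
    value-∙ a b (yes _)  (no _)   (no _)     = refl

    table-isChar : IsChar q table
    table-isChar = multiplicative , vanishing
      where
      multiplicative : ∀ a b → lookup table (a ∙ b) ≡ lookup table a ·v lookup table b
      multiplicative a b = trans (lookup-table (a ∙ b))
        (trans (value-∙ a b (Unit? q a) (Unit? q b) (Unit? q (a ∙ b))) (sym (cong₂ _·v_ (lookup-table a) (lookup-table b))))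
      vanishing-value : ∀ a (ua? : Dec (Unit q a)) → (value a ua? ≡ nothing → ¬ Unit q a) × (¬ Unit q a → value a ua? ≡ nothing)
      vanishing-value a (yes ua) = (λ ()) , (λ ¬ua → contradiction ua ¬ua)
      vanishing-value a (no ¬ua) = (λ _ → ¬ua) , (λ _ → refl)
      vanishing : ∀ a → (lookup table a ≡ nothing → ¬ Unit q a) × (¬ Unit q a → lookup table a ≡ nothing)
      vanishing a = (λ t≡0 → proj₁ (vanishing-value a (Unit? q a)) (trans (sym (lookup-table a)) t≡0))
                  , (λ ¬ua → trans (lookup-table a) (proj₂ (vanishing-value a (Unit? q a)) ¬ua))

    table-extends : Extends S ψ table
    table-extends x x∈S = trans (lookup-table x) (by-unit (Unit? q x))
      where
      by-unit : (ux? : Dec (Unit q x)) → value x ux? ≡ just (ψ x)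
      by-unit (yes _)  = refl
      by-unit (no ¬ux) = contradiction (∈⇒Unit S x∈S) ¬ux

    extends⇒≡table : ∀ {χ} → IsChar q χ → Extends S ψ χ → χ ≡ table
    extends⇒≡table {χ} isChar extends = trans (sym (tabulate∘lookup χ)) (tabulate-cong (λ y → by-unit y (Unit? q y)))
      where
      by-unit : ∀ y (uy? : Dec (Unit q y)) → lookup χ y ≡ value y uy?
      by-unit y (yes uy) = extends y (full uy)
      by-unit y (no ¬uy) = Character.χ-nonunit χ isChar ¬uy

    extensions-full : extensions S ψ ≡ 1
    extensions-full = begin
      count (Extends? S ψ) (filter (IsChar? q) (allVecs (allVals N) q))       ≡⟨ count-filter (IsChar? q) (Extends? S ψ) (allVecs (allVals N) q) ⟩
      count (λ χ → IsChar? q χ ×-dec Extends? S ψ χ) (allVecs (allVals N) q)  ≡⟨ count-cong _ (λ χ → ≡-dec _≟v_ χ table)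
                                                                                   (All.universal (λ χ → uncurry extends⇒≡table , λ { refl → table-isChar , table-extends })
                                                                                                  (allVecs (allVals N) q)) ⟩
      count (λ χ → ≡-dec _≟v_ χ table) (allVecs (allVals N) q)               ≡⟨ count-allVecs _≟v_ (count-allVals N) table ⟩
      1                                                                       ∎

  module CharacterExtension (S : Subgroup) (g : Fin q) (ug : Unit q g) (ψ : Fin q → Fin N) (hom : Hom S ψ) where

    open Extension S g ug

    u : Fin N
    u = ψ (g ^ m)

    Valid : Pred (Fin N) 0ℓ
    Valid x = m · x ≡ u

    Valid? : Decidable Valid
    Valid? x = m · x ≟ᶠ u

    ψhᵐ⊕u≡0 : ψ (h ^ m) ⊕ u ≡ 0ᴺ
    ψhᵐ⊕u≡0 = trans (sym (homo hom hᵐ∈S gᵐ∈S)) (trans (cong ψ (hʲgʲ≡ε m)) (hom-ε hom))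

    module _ (x : Fin N) (valid : Valid x) where

      shift : ∀ {y} i t → y ∙ h ^ i ∈ S → ψ (y ∙ h ^ (i + t * m)) ⊕ (i + t * m) · x ≡ ψ (y ∙ h ^ i) ⊕ i · x
      shift {y} i t p = begin
        ψ (y ∙ h ^ (i + t * m)) ⊕ (i + t * m) · x
          ≡⟨ cong₂ _⊕_ (cong ψ y∙hⁱ⁺ᵗᵐ) (×-homo-+ x i (t * m)) ⟩
        ψ ((y ∙ h ^ i) ∙ (h ^ m) ^ t) ⊕ (i · x ⊕ (t * m) · x)
          ≡⟨ cong₂ _⊕_ (homo hom p (^∈ S t hᵐ∈S)) (cong (i · x ⊕_) (trans (sym (×-assocˡ x t m)) (cong (t ·_) valid))) ⟩
        (ψ (y ∙ h ^ i) ⊕ ψ ((h ^ m) ^ t)) ⊕ (i · x ⊕ t · u)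
          ≡⟨ cong (λ v → (ψ (y ∙ h ^ i) ⊕ v) ⊕ (i · x ⊕ t · u)) (hom-^ hom t hᵐ∈S) ⟩
        (ψ (y ∙ h ^ i) ⊕ t · ψ (h ^ m)) ⊕ (i · x ⊕ t · u)
          ≡⟨ ⊕-interchange _ _ _ _ ⟩
        (ψ (y ∙ h ^ i) ⊕ i · x) ⊕ (t · ψ (h ^ m) ⊕ t · u)
          ≡⟨ cong (ψ (y ∙ h ^ i) ⊕ i · x ⊕_) (trans (sym (×-distrib-+ (ψ (h ^ m)) u t)) (trans (cong (t ·_) ψhᵐ⊕u≡0) (·0ᴺ t))) ⟩
        (ψ (y ∙ h ^ i) ⊕ i · x) ⊕ 0ᴺ
          ≡⟨ ⊕-identityʳ _ ⟩
        ψ (y ∙ h ^ i) ⊕ i · x ∎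
        where
        y∙hⁱ⁺ᵗᵐ : y ∙ h ^ (i + t * m) ≡ (y ∙ h ^ i) ∙ (h ^ m) ^ t
        y∙hⁱ⁺ᵗᵐ = begin
          y ∙ h ^ (i + t * m)          ≡⟨ cong (y ∙_) (^-+ h i (t * m)) ⟩
          y ∙ (h ^ i ∙ h ^ (t * m))    ≡⟨ assoc y _ _ ⟨
          (y ∙ h ^ i) ∙ h ^ (t * m)    ≡⟨ cong (λ k → (y ∙ h ^ i) ∙ h ^ k) (*-comm t m) ⟩
          (y ∙ h ^ i) ∙ h ^ (m * t)    ≡⟨ cong ((y ∙ h ^ i) ∙_) (^-* h m t) ⟩
          (y ∙ h ^ i) ∙ (h ^ m) ^ t    ∎

      well-defined-≤ : ∀ {y i j} → i ≤ j → y ∙ h ^ i ∈ S → y ∙ h ^ j ∈ S →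
                       ψ (y ∙ h ^ j) ⊕ j · x ≡ ψ (y ∙ h ^ i) ⊕ i · x
      well-defined-≤ {y} {i} {j} i≤j p p′ = subst (λ k → ψ (y ∙ h ^ k) ⊕ k · x ≡ ψ (y ∙ h ^ i) ⊕ i · x) i+tm≡j (shift i t p)
        where
        m∣j∸i : m ∣ j ∸ i
        m∣j∸i = hᵈ∈S⇒m∣d (hᵈ∈S i (j ∸ i) p (subst (λ k → y ∙ h ^ k ∈ S) (sym (m+[n∸m]≡n i≤j)) p′))
        t : ℕ
        t = quotient m∣j∸i
        i+tm≡j : i + t * m ≡ j
        i+tm≡j = trans (cong (i +_) (sym (m∣n⇒n≡quotient*m m∣j∸i))) (m+[n∸m]≡n i≤j)

      well-defined : ∀ {y} i j → y ∙ h ^ i ∈ S → y ∙ h ^ j ∈ S → ψ (y ∙ h ^ i) ⊕ i · x ≡ ψ (y ∙ h ^ j) ⊕ j · x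
      well-defined i j p p′ with ≤-total i j
      ... | inj₁ i≤j = sym (well-defined-≤ i≤j p p′)
      ... | inj₂ j≤i = well-defined-≤ j≤i p′ p

    ψ⁺-by-cases : Fin N → ∀ y → Dec (Member y) → Fin N
    ψ⁺-by-cases x y (yes (j , _)) = ψ (y ∙ h ^ toℕ j) ⊕ toℕ j · x
    ψ⁺-by-cases x y (no _)        = 0ᴺ

    -- The extension of ψ to ⟨S, g⟩ sending g to x.
    ψ⁺ : Fin N → Fin q → Fin N
    ψ⁺ x y = ψ⁺-by-cases x y (Member? y)

    module _ (x : Fin N) (valid : Valid x) where

      ψ⁺-at : ∀ {y} j → y ∙ h ^ j ∈ S → ψ⁺ x y ≡ ψ (y ∙ h ^ j) ⊕ j · x
      ψ⁺-at {y} j p = by-cases (Member? y)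
        where
        by-cases : (y∈? : Dec (Member y)) → ψ⁺-by-cases x y y∈? ≡ ψ (y ∙ h ^ j) ⊕ j · x
        by-cases (yes (i , p′)) = well-defined x valid (toℕ i) j p′ p
        by-cases (no y∉)        = contradiction (member j p) y∉

      hom⁺ : Hom extension (ψ⁺ x)
      homo hom⁺ {y} {z} (i , p) (j , p′) = begin
        ψ⁺ x (y ∙ z)
          ≡⟨ ψ⁺-at (toℕ i + toℕ j) (subst (_∈ S) (sym (∙-h^-+ y z (toℕ i) (toℕ j))) (∙∈ S p p′)) ⟩
        ψ ((y ∙ z) ∙ h ^ (toℕ i + toℕ j)) ⊕ (toℕ i + toℕ j) · x
          ≡⟨ cong₂ _⊕_ (trans (cong ψ (∙-h^-+ y z (toℕ i) (toℕ j))) (homo hom p p′)) (×-homo-+ x (toℕ i) (toℕ j)) ⟩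
        (ψ (y ∙ h ^ toℕ i) ⊕ ψ (z ∙ h ^ toℕ j)) ⊕ (toℕ i · x ⊕ toℕ j · x)
          ≡⟨ ⊕-interchange _ _ _ _ ⟩
        (ψ (y ∙ h ^ toℕ i) ⊕ toℕ i · x) ⊕ (ψ (z ∙ h ^ toℕ j) ⊕ toℕ j · x)
          ≡⟨ cong₂ _⊕_ (ψ⁺-at (toℕ i) p) (ψ⁺-at (toℕ j) p′) ⟨
        ψ⁺ x y ⊕ ψ⁺ x z ∎

      ψ⁺-on-S : ∀ {y} → y ∈ S → ψ⁺ x y ≡ ψ y
      ψ⁺-on-S {y} y∈S = begin
        ψ⁺ x y             ≡⟨ ψ⁺-at 0 (subst (_∈ S) (sym (identityʳ y)) y∈S) ⟩
        ψ (y ∙ ε) ⊕ 0ᴺ     ≡⟨ ⊕-identityʳ _ ⟩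
        ψ (y ∙ ε)          ≡⟨ cong ψ (identityʳ y) ⟩
        ψ y                ∎

      ψ⁺-g : ψ⁺ x g ≡ x
      ψ⁺-g = begin
        ψ⁺ x g                 ≡⟨ ψ⁺-at 1 (subst (_∈ S) (sym g∙h¹≡ε) (ε∈ S)) ⟩
        ψ (g ∙ h ^ 1) ⊕ 1 · x  ≡⟨ cong₂ _⊕_ (trans (cong ψ g∙h¹≡ε) (hom-ε hom)) (⊕-identityʳ x) ⟩
        0ᴺ ⊕ x                 ≡⟨ ⊕-identityˡ x ⟩
        x                      ∎
        where
        g∙h¹≡ε : g ∙ h ^ 1 ≡ ε
        g∙h¹≡ε = trans (cong (g ∙_) (identityʳ h)) (inverseʳ ug)

      module _ (χ : Fun q) (isChar : IsChar q χ) where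

        open Character χ isChar

        extends⁺ : Extends S ψ χ → lookup χ g ≡ just x → Extends extension (ψ⁺ x) χ
        extends⁺ extends χg≡x y (j , p) = begin
          lookup χ y                                          ≡⟨ cong (lookup χ) (cancelʳ (hʲgʲ≡ε (toℕ j)) y) ⟨
          lookup χ ((y ∙ h ^ toℕ j) ∙ g ^ toℕ j)              ≡⟨ χ-∙ _ _ ⟩
          lookup χ (y ∙ h ^ toℕ j) ·v lookup χ (g ^ toℕ j)    ≡⟨ cong₂ _·v_ (extends _ p) (χ-^ χg≡x (toℕ j)) ⟩
          just (ψ (y ∙ h ^ toℕ j) ⊕ toℕ j · x)                ≡⟨ cong just (ψ⁺-at (toℕ j) p) ⟨
          just (ψ⁺ x y)                                       ∎

        extends⁻ : Extends extension (ψ⁺ x) χ → Extends S ψ χ × lookup χ g ≡ just x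
        extends⁻ extends⁺ = (λ y y∈S → trans (extends⁺ y (∈⇒Member y∈S)) (cong just (ψ⁺-on-S y∈S)))
                          , trans (extends⁺ g g-Member) (cong just ψ⁺-g)

    value-at-g : ∀ χ → IsChar q χ → Extends S ψ χ → ∃[ x ] lookup χ g ≡ just x × Valid x
    value-at-g χ isChar extends with Character.χ-unit χ isChar g ug
    ... | x , χg≡x = x , χg≡x , just-injective (begin
      just (m · x)     ≡⟨ Character.χ-^ χ isChar χg≡x m ⟨
      lookup χ (g ^ m) ≡⟨ extends (g ^ m) gᵐ∈S ⟩
      just u           ∎)

    m∣N : m ∣ N
    m∣N = ∣-trans (m∣m*n (size S)) (subst (_∣ N) size-extension (size∣φ extension))

    -- (N/m)·u = ψ(gᴺ) = ψ(ε) = 0 by Euler's theorem, so m divides u.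
    m∣u : m ∣ toℕ u
    m∣u = *-cancelˡ-∣ t (subst (_∣ t * toℕ u) N≡t*m N∣t*u)
      where
      t : ℕ
      t = quotient m∣N
      N≡t*m : N ≡ t * m
      N≡t*m = m∣n⇒n≡quotient*m m∣N
      instance
        t-nonZero : NonZero t
        t-nonZero = m*n≢0⇒m≢0 t {{subst NonZero N≡t*m N-nonZero}}
      t·u≡0 : t · u ≡ 0ᴺ
      t·u≡0 = begin
        t · ψ (g ^ m)     ≡⟨ hom-^ hom t gᵐ∈S ⟨
        ψ ((g ^ m) ^ t)   ≡⟨ cong ψ (trans (sym (^-* g m t)) (trans (cong (g ^_) (trans (*-comm m t) (sym N≡t*m))) (^φ≡ε g ug))) ⟩
        ψ ε               ≡⟨ hom-ε hom ⟩
        0ᴺ                ∎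
      N∣t*u : N ∣ t * toℕ u
      N∣t*u = m%n≡0⇒n∣m (t * toℕ u) N (trans (sym (toℕ-· t u)) (trans (cong toℕ t·u≡0) toℕ-0ᴺ))

    count-valid : count Valid? (allFin N) ≡ m
    count-valid = trans (count-cong Valid? (λ x → (m * toℕ x) % N ≟ toℕ u)
                          (All.universal (λ x → trans (sym (toℕ-· m x)) ∘ cong toℕ , toℕ-injective ∘ trans (toℕ-· m x)) (allFin N)))
                        (count-solutions m m∣N m∣u (toℕ<n u))

    valids : List (Fin N)
    valids = filter Valid? (allFin N)

    extensions-split : extensions S ψ ≡ sum (map (λ x → extensions extension (ψ⁺ x)) valids)
    extensions-split = begin
      count (Extends? S ψ) (Chars q)
        ≡⟨ count-partition R? (Extends? S ψ) valids (Chars q) (All.map fibre Chars-isChar) ⟩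
      sum (map (λ x → count (R? x) (Chars q)) valids)
        ≡⟨ cong sum (map-cong-local (All.map restrict (all-filter Valid? (allFin N)))) ⟩
      sum (map (λ x → extensions extension (ψ⁺ x)) valids) ∎
      where
      R : Fin N → Pred (Fun q) 0ℓ
      R x χ = Extends S ψ χ × lookup χ g ≡ just x
      R? : ∀ x → Decidable (R x)
      R? x χ = Extends? S ψ χ ×-dec (lookup χ g ≟v just x)
      fibre : ∀ {χ} → IsChar q χ → count (λ x → R? x χ) valids ≡ count (Extends? S ψ) [ χ ]
      fibre {χ} isChar = by-cases (Extends? S ψ χ)
        where
        by-cases : Dec (Extends S ψ χ) → count (λ x → R? x χ) valids ≡ count (Extends? S ψ) [ χ ]
        by-cases (yes extends) with value-at-g χ isChar extends
        ... | x₀ , χg≡x₀ , valid₀ = begin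
          count (λ x → R? x χ) valids                             ≡⟨ count-filter Valid? (λ x → R? x χ) (allFin N) ⟩
          count (λ x → Valid? x ×-dec R? x χ) (allFin N)          ≡⟨ count-unique (λ x → Valid? x ×-dec R? x χ) (valid₀ , extends , χg≡x₀)
                                                                       (λ (_ , _ , χg≡x) → just-injective (trans (sym χg≡x) χg≡x₀)) ⟩
          1                                                       ≡⟨ count-accept (Extends? S ψ) extends ⟨
          count (Extends? S ψ) [ χ ]                              ∎
        by-cases (no ¬extends) = trans (count-none (λ x → R? x χ) (All.universal (λ _ → ¬extends ∘ proj₁) valids))
                                       (sym (count-reject (Extends? S ψ) ¬extends))
      restrict : ∀ {x} → Valid x → count (R? x) (Chars q) ≡ extensions extension (ψ⁺ x)
      restrict {x} valid = count-cong (R? x) (Extends? extension (ψ⁺ x))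
        (All.map (λ {χ} isChar → (λ (extends , χg≡x) → extends⁺ x valid χ isChar extends χg≡x) , extends⁻ x valid χ isChar) Chars-isChar)

    extensions-size-step : (∀ {x} → Valid x → extensions extension (ψ⁺ x) * size extension ≡ N) →
                           extensions S ψ * size S ≡ N
    extensions-size-step ih = *-cancelˡ-≡ _ _ m (begin
      m * (extensions S ψ * size S)
        ≡⟨ x∙yz≈y∙xz m (extensions S ψ) (size S) ⟩
      extensions S ψ * (m * size S)
        ≡⟨ cong₂ _*_ extensions-split (sym size-extension) ⟩
      sum (map (λ x → extensions extension (ψ⁺ x)) valids) * size extension
        ≡⟨ sum-map-*ʳ (λ x → extensions extension (ψ⁺ x)) (size extension) valids ⟩
      sum (map (λ x → extensions extension (ψ⁺ x) * size extension) valids)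
        ≡⟨ cong sum (map-cong-local (All.map ih (all-filter Valid? (allFin N)))) ⟩
      sum (map (λ _ → N) valids)
        ≡⟨ sum-map-const N valids ⟩
      count Valid? (allFin N) * N
        ≡⟨ cong (_* N) count-valid ⟩
      m * N ∎)
      where open CommutativeSemigroupProperties *-commutativeSemigroup using (x∙yz≈y∙xz)

  open CharacterExtension using (ψ⁺; hom⁺; extensions-size-step)

  extensions-size : ∀ S ψ → Hom S ψ → extensions S ψ * size S ≡ N
  extensions-size = subgroup-induction (λ S → ∀ ψ → Hom S ψ → extensions S ψ * size S ≡ N)
    (λ S full ψ hom → trans (cong₂ _*_ (Full.extensions-full hom full) (size-full S full)) (+-identityʳ N))
    (λ S g ug ih ψ hom → extensions-size-step S g ug ψ hom (λ {x} valid → ih (ψ⁺ S g ug ψ hom x) (hom⁺ S g ug ψ hom x valid)))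

  module Half (2∣N : 2 ∣ N) where

    k : ℕ
    k = quotient 2∣N

    N≡k*2 : N ≡ k * 2
    N≡k*2 = m∣n⇒n≡quotient*m 2∣N

    instance
      k-nonZero : NonZero k
      k-nonZero = m*n≢0⇒m≢0 k {{subst NonZero N≡k*2 N-nonZero}}

    k<N : k < N
    k<N = subst (k <_) (sym (trans N≡k*2 (trans (*-comm k 2) (cong (k +_) (+-identityʳ k))))) (m<m+n k (>-nonZero⁻¹ k))

    -- ζ^half = -1.
    half : Fin N
    half = residue k

    toℕ-half : toℕ half ≡ k
    toℕ-half = trans (toℕ-residue k) (m<n⇒m%n≡m k<N)

    half≢0ᴺ : half ≢ 0ᴺ
    half≢0ᴺ half≡0 = ≢-nonZero⁻¹ k (trans (sym toℕ-half) (trans (cong toℕ half≡0) toℕ-0ᴺ))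

    toℕ-⊕half : ∀ x → toℕ (x ⊕ half) ≡ (toℕ x + N / 2) % N
    toℕ-⊕half x = trans (toℕ-addMod x half) (cong (λ t → (toℕ x + t) % N) (trans toℕ-half (sym N/2≡k)))
      where
      N/2≡k : N / 2 ≡ k
      N/2≡k = trans (cong (_/ 2) N≡k*2) (m*n/n≡m k 2)

    NegR⇔≡⊕half : ∀ {x y} → NegR x y ⇔ (y ≡ x ⊕ half)
    NegR⇔≡⊕half {x} {y} = mk⇔ (λ negR → toℕ-injective (trans (Equivalence.to (NegR⇔ 2∣N) negR) (sym (toℕ-⊕half x))))
                              (λ y≡x⊕half → Equivalence.from (NegR⇔ 2∣N) (trans (cong toℕ y≡x⊕half) (toℕ-⊕half x)))

    half⊕half : half ⊕ half ≡ 0ᴺ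
    half⊕half = toℕ-injective (begin
      toℕ (half ⊕ half)               ≡⟨ toℕ-addMod half half ⟩
      (toℕ half + toℕ half) % N       ≡⟨ cong (λ t → (t + t) % N) toℕ-half ⟩
      (k + k) % N                     ≡⟨ cong (_% N) (trans (*-comm k 2) (cong (k +_) (+-identityʳ k))) ⟨
      (k * 2) % N                     ≡⟨ cong (_% N) N≡k*2 ⟨
      N % N                           ≡⟨ n%n≡0 N ⟩
      0                               ≡⟨ toℕ-0ᴺ ⟨
      toℕ 0ᴺ                          ∎)

    2-torsion : ∀ {v} → v ⊕ v ≡ 0ᴺ → v ≡ 0ᴺ ⊎ v ≡ half
    2-torsion {v} v⊕v≡0 with m*2∣n*2⇒n≡0∨n≡m k (subst (toℕ v <_) N≡k*2 (toℕ<n v)) (subst (_∣ toℕ v * 2) N≡k*2 N∣v*2)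
      where
      N∣v*2 : N ∣ toℕ v * 2
      N∣v*2 = m%n≡0⇒n∣m (toℕ v * 2) N (begin
        (toℕ v * 2) % N              ≡⟨ cong (_% N) (*-comm (toℕ v) 2) ⟩
        (toℕ v + (toℕ v + 0)) % N    ≡⟨ cong (λ t → (toℕ v + t) % N) (+-identityʳ (toℕ v)) ⟩
        (toℕ v + toℕ v) % N          ≡⟨ toℕ-addMod v v ⟨
        toℕ (v ⊕ v)                  ≡⟨ cong toℕ v⊕v≡0 ⟩
        toℕ 0ᴺ                       ≡⟨ toℕ-0ᴺ ⟩
        0                            ∎)
    ... | inj₁ v≡0 = inj₁ (toℕ-injective (trans v≡0 (sym toℕ-0ᴺ)))
    ... | inj₂ v≡k = inj₂ (toℕ-injective (trans v≡k (sym toℕ-half)))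

    sign : Bool → Fin N
    sign false = 0ᴺ
    sign true  = half

    sign-not : ∀ s → sign (not s) ≡ sign s ⊕ half
    sign-not false = sym (⊕-identityˡ half)
    sign-not true  = sym half⊕half

    sign-injective : ∀ {s t} → sign s ≡ sign t → s ≡ t
    sign-injective {false} {false} _ = refl
    sign-injective {false} {true}  0≡half = contradiction (sym 0≡half) half≢0ᴺ
    sign-injective {true}  {false} half≡0 = contradiction half≡0 half≢0ᴺ
    sign-injective {true}  {true}  _ = refl

    2·sign : ∀ s → 2 · sign s ≡ 0ᴺ
    2·sign false = ·0ᴺ 2
    2·sign true  = trans (cong (half ⊕_) (⊕-identityʳ half)) half⊕half

    2-torsion-sign : ∀ {v} → v ⊕ v ≡ 0ᴺ → ∃[ s ] v ≡ sign s
    2-torsion-sign v⊕v≡0 with 2-torsion v⊕v≡0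
    ... | inj₁ v≡0    = false , v≡0
    ... | inj₂ v≡half = true , v≡half

    module _ (z : Fin N) where

      shifted-sign-injective : ∀ {s t} → sign s ⊕ z ≡ sign t ⊕ z → s ≡ t
      shifted-sign-injective {s} {t} e = sign-injective (∙-cancelʳ z (sign s) (sign t) e)

      NegR-shifted-sign : ∀ {s t} → NegR (sign s ⊕ z) (sign t ⊕ z) ⇔ (t ≡ not s)
      NegR-shifted-sign {s} {t} = ⇔-trans NegR⇔≡⊕half (mk⇔ (shifted-sign-injective ∘ flip trans ⊕half) (λ { refl → sym ⊕half }))
        where
        ⊕half : (sign s ⊕ z) ⊕ half ≡ sign (not s) ⊕ z
        ⊕half = begin
          (sign s ⊕ z) ⊕ half    ≡⟨ ⊕-assoc (sign s) z half ⟩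
          sign s ⊕ (z ⊕ half)    ≡⟨ cong (sign s ⊕_) (⊕-comm z half) ⟩
          sign s ⊕ (half ⊕ z)    ≡⟨ ⊕-assoc (sign s) half z ⟨
          (sign s ⊕ half) ⊕ z    ≡⟨ cong (_⊕ z) (sign-not s) ⟨
          sign (not s) ⊕ z       ∎

-- The sets H₀, H₁, H₂, H₃

-- The shape of Defs.H, for any values c₁ c₂ c₃ and any negation relation.
Pattern : {A : Set} → (A → A → Set) → Fin 4 → A → A → A → Set
Pattern Neg zero                c₁ c₂ c₃ = (c₁ ≡ c₂) × (c₂ ≡ c₃)
Pattern Neg (suc zero)          c₁ c₂ c₃ = (c₂ ≡ c₃) × Neg c₁ c₃
Pattern Neg (suc (suc zero))    c₁ c₂ c₃ = (c₁ ≡ c₃) × Neg c₂ c₃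
Pattern Neg (suc (suc (suc _))) c₁ c₂ c₃ = (c₁ ≡ c₂) × Neg c₃ c₂

H⇔Pattern : ∀ {q} a₁ a₂ a₃ i (χ : Fun q) → H q a₁ a₂ a₃ i χ ⇔ Pattern IsNeg i (lookup χ a₁) (lookup χ a₂) (lookup χ a₃)
H⇔Pattern a₁ a₂ a₃ zero                χ = mk⇔ id id
H⇔Pattern a₁ a₂ a₃ (suc zero)          χ = mk⇔ id id
H⇔Pattern a₁ a₂ a₃ (suc (suc zero))    χ = mk⇔ id id
H⇔Pattern a₁ a₂ a₃ (suc (suc (suc _))) χ = mk⇔ id id

Pattern-cong : ∀ {A : Set} (Neg : A → A → Set) i {c₁ c₂ c₃ c₁′ c₂′ c₃′} → c₁ ≡ c₁′ → c₂ ≡ c₂′ → c₃ ≡ c₃′ →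
               Pattern Neg i c₁ c₂ c₃ ⇔ Pattern Neg i c₁′ c₂′ c₃′
Pattern-cong Neg i refl refl refl = mk⇔ id id

module _ {A B : Set} (Neg : B → B → Set) (Neg′ : A → A → Set) (f : A → B)
         (f-injective : ∀ {a a′} → f a ≡ f a′ → a ≡ a′) (Neg⇔ : ∀ {a a′} → Neg (f a) (f a′) ⇔ Neg′ a a′) where

  private
    ≡⇔ : ∀ {a a′} → (f a ≡ f a′) ⇔ (a ≡ a′)
    ≡⇔ = mk⇔ f-injective (cong f)

  Pattern-map : ∀ i {a₁ a₂ a₃} → Pattern Neg i (f a₁) (f a₂) (f a₃) ⇔ Pattern Neg′ i a₁ a₂ a₃
  Pattern-map zero                = ≡⇔ ×-⇔ ≡⇔
  Pattern-map (suc zero)          = ≡⇔ ×-⇔ Neg⇔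
  Pattern-map (suc (suc zero))    = ≡⇔ ×-⇔ Neg⇔
  Pattern-map (suc (suc (suc _))) = ≡⇔ ×-⇔ Neg⇔

code : Fin 4 → Bool × Bool
code zero                = false , false
code (suc zero)          = true  , false
code (suc (suc zero))    = false , true
code (suc (suc (suc _))) = true  , true

decode : Bool × Bool → Fin 4
decode (false , false) = zero
decode (true  , false) = suc zero
decode (false , true)  = suc (suc zero)
decode (true  , true)  = suc (suc (suc zero))

code-decode : ∀ p → code (decode p) ≡ p
code-decode (false , false) = refl
code-decode (true  , false) = refl
code-decode (false , true)  = refl
code-decode (true  , true)  = refl

decode-code : ∀ i → decode (code i) ≡ i
decode-code zero                   = refl
decode-code (suc zero)             = refl
decode-code (suc (suc zero))       = refl
decode-code (suc (suc (suc zero))) = refl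

Pattern-Bool⇔code : ∀ i {s₁ s₂} → Pattern (λ s t → t ≡ not s) i s₁ s₂ false ⇔ ((s₁ , s₂) ≡ code i)
Pattern-Bool⇔code i = mk⇔ (to i) (from i)
  where
  to : ∀ i {s₁ s₂} → Pattern (λ s t → t ≡ not s) i s₁ s₂ false → (s₁ , s₂) ≡ code i
  to zero                               (refl , refl) = refl
  to (suc zero)             {true}      (refl , refl) = refl
  to (suc (suc zero))       {s₂ = true} (refl , refl) = refl
  to (suc (suc (suc zero)))             (refl , refl) = refl
  from : ∀ i {s₁ s₂} → (s₁ , s₂) ≡ code i → Pattern (λ s t → t ≡ not s) i s₁ s₂ false
  from zero                   refl = refl , refl
  from (suc zero)             refl = refl , refl
  from (suc (suc zero))       refl = refl , refl
  from (suc (suc (suc zero))) refl = refl , refl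

module KleinFour (q : ℕ) .{{_ : NonZero q}} {a₁ a₂ a₃ : Fin q} (u₁ : Unit q a₁) (u₂ : Unit q a₂) (u₃ : Unit q a₃)
                 (a₁≢a₂ : a₁ ≢ a₂) (a₁≢a₃ : a₁ ≢ a₃) (a₂≢a₃ : a₂ ≢ a₃)
                 (a₁²≡a₂² : mulMod a₁ a₁ ≡ mulMod a₂ a₂) (a₂²≡a₃² : mulMod a₂ a₂ ≡ mulMod a₃ a₃) where

  open Units q
  open Characters q

  b c : Fin q
  b = a₁ ∙ a₃ ⁻¹
  c = a₂ ∙ a₃ ⁻¹

  ub : Unit q b
  ub = Unit-∙ u₁ (Unit-⁻¹ u₃)

  uc : Unit q c
  uc = Unit-∙ u₂ (Unit-⁻¹ u₃)

  b∙a₃≡a₁ : b ∙ a₃ ≡ a₁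
  b∙a₃≡a₁ = cancelʳ (inverseˡ u₃) a₁

  c∙a₃≡a₂ : c ∙ a₃ ≡ a₂
  c∙a₃≡a₂ = cancelʳ (inverseˡ u₃) a₂

  b²≡ε : b ∙ b ≡ ε
  b²≡ε = ratio-square u₃ (trans a₁²≡a₂² a₂²≡a₃²)

  c²≡ε : c ∙ c ≡ ε
  c²≡ε = ratio-square u₃ a₂²≡a₃²

  b≢ε : b ≢ ε
  b≢ε b≡ε = a₁≢a₃ (trans (sym b∙a₃≡a₁) (trans (cong (_∙ a₃) b≡ε) (identityˡ a₃)))

  c≢ε : c ≢ ε
  c≢ε c≡ε = a₂≢a₃ (trans (sym c∙a₃≡a₂) (trans (cong (_∙ a₃) c≡ε) (identityˡ a₃)))

  b≢c : b ≢ c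
  b≢c b≡c = a₁≢a₂ (trans (sym b∙a₃≡a₁) (trans (cong (_∙ a₃) b≡c) c∙a₃≡a₂))

  module ⟨b⟩ = Extension trivial b ub

  B : Subgroup
  B = ⟨b⟩.extension

  module ⟨b,c⟩ = Extension B c uc

  K : Subgroup
  K = ⟨b,c⟩.extension

  m⟨b⟩≡2 : ⟨b⟩.m ≡ 2
  m⟨b⟩≡2 = ⟨b⟩.m≡2 b≢ε b²≡ε

  c∉B : c ∉ B
  c∉B (j , c∙b⁻ʲ≡ε) = excluded (toℕ j) (subst (toℕ j <_) m⟨b⟩≡2 (toℕ<n j)) c∙b⁻ʲ≡ε
    where
    excluded : ∀ n → n < 2 → c ∙ b ⁻¹ ^ n ≢ ε
    excluded 0 _ c∙ε≡ε = c≢ε (trans (sym (identityʳ c)) c∙ε≡ε)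
    excluded 1 _ c∙b⁻¹≡ε = b≢c (begin
      b                  ≡⟨ identityˡ b ⟨
      ε ∙ b              ≡⟨ cong (_∙ b) (trans (sym c∙b⁻¹≡ε) (cong (c ∙_) (identityʳ (b ⁻¹)))) ⟩
      (c ∙ b ⁻¹) ∙ b     ≡⟨ cancelʳ (inverseˡ ub) c ⟩
      c                  ∎)
    excluded (suc (suc _)) (s≤s (s≤s ()))

  m⟨b,c⟩≡2 : ⟨b,c⟩.m ≡ 2
  m⟨b,c⟩≡2 = ⟨b,c⟩.m≡2 c∉B (subst (_∈ B) (sym c²≡ε) (ε∈ B))

  size-K : size K ≡ 4
  size-K = begin
    size K                       ≡⟨ ⟨b,c⟩.size-extension ⟩
    ⟨b,c⟩.m * size B             ≡⟨ cong (⟨b,c⟩.m *_) ⟨b⟩.size-extension ⟩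
    ⟨b,c⟩.m * (⟨b⟩.m * size trivial) ≡⟨ cong₂ (λ m m′ → m * (m′ * size trivial)) m⟨b,c⟩≡2 m⟨b⟩≡2 ⟩
    2 * (2 * size trivial)       ≡⟨ cong (λ n → 2 * (2 * n)) (count-≟-allFin ε) ⟩
    4                            ∎

  2∣N : 2 ∣ N
  2∣N = ∣-trans (divides 2 refl) (subst (_∣ N) size-K (size∣φ K))

  open Half 2∣N

  module PrescribedValues (t₁ t₂ : Bool) where

    ψ₀ : Fin q → Fin N
    ψ₀ _ = 0ᴺ

    hom₀ : Hom trivial ψ₀
    homo hom₀ _ _ = sym (⊕-identityˡ 0ᴺ)

    module ψ⟨b⟩ = CharacterExtension trivial b ub ψ₀ hom₀

    valid₁ : ψ⟨b⟩.Valid (sign t₁)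
    valid₁ = subst (λ m → m · sign t₁ ≡ 0ᴺ) (sym m⟨b⟩≡2) (2·sign t₁)

    ψ₁ : Fin q → Fin N
    ψ₁ = ψ⟨b⟩.ψ⁺ (sign t₁)

    module ψ⟨b,c⟩ = CharacterExtension B c uc ψ₁ (ψ⟨b⟩.hom⁺ (sign t₁) valid₁)

    valid₂ : ψ⟨b,c⟩.Valid (sign t₂)
    valid₂ = subst (λ m → m · sign t₂ ≡ ψ₁ (c ^ m)) (sym m⟨b,c⟩≡2)
                   (trans (2·sign t₂) (sym (trans (cong ψ₁ (trans (cong (c ∙_) (identityʳ c)) c²≡ε)) (hom-ε (ψ⟨b⟩.hom⁺ (sign t₁) valid₁)))))

    ψ₂ : Fin q → Fin N
    ψ₂ = ψ⟨b,c⟩.ψ⁺ (sign t₂)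

    Extends-K⇔ : ∀ χ → IsChar q χ → Extends K ψ₂ χ ⇔ (lookup χ b ≡ just (sign t₁) × lookup χ c ≡ just (sign t₂))
    Extends-K⇔ χ isChar = mk⇔
      (λ extends → let extends-B , χc = ψ⟨b,c⟩.extends⁻ (sign t₂) valid₂ χ isChar extends
                   in proj₂ (ψ⟨b⟩.extends⁻ (sign t₁) valid₁ χ isChar extends-B) , χc)
      (λ (χb , χc) → ψ⟨b,c⟩.extends⁺ (sign t₂) valid₂ χ isChar
                       (ψ⟨b⟩.extends⁺ (sign t₁) valid₁ χ isChar (λ { _ refl → Character.χ-ε χ isChar }) χb) χc)

    4*extensions≡N : 4 * extensions K ψ₂ ≡ N
    4*extensions≡N = begin
      4 * extensions K ψ₂           ≡⟨ *-comm 4 (extensions K ψ₂) ⟩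
      extensions K ψ₂ * 4           ≡⟨ cong (extensions K ψ₂ *_) size-K ⟨
      extensions K ψ₂ * size K      ≡⟨ extensions-size K ψ₂ (ψ⟨b,c⟩.hom⁺ (sign t₂) valid₂) ⟩
      N                             ∎

  module Signs (χ : Fun q) (isChar : IsChar q χ) where

    open Character χ isChar

    χ-2-torsion : ∀ {g v} → g ∙ g ≡ ε → lookup χ g ≡ just v → v ⊕ v ≡ 0ᴺ
    χ-2-torsion {g} {v} g²≡ε χg≡v = just-injective (begin
      just (v ⊕ v)                ≡⟨ cong₂ _·v_ χg≡v χg≡v ⟨
      lookup χ g ·v lookup χ g    ≡⟨ χ-∙ g g ⟨
      lookup χ (g ∙ g)            ≡⟨ cong (lookup χ) g²≡ε ⟩
      lookup χ ε                  ≡⟨ χ-ε ⟩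
      just 0ᴺ                     ∎)

    sign-at : ∀ g → Unit q g → g ∙ g ≡ ε → ∃[ s ] lookup χ g ≡ just (sign s)
    sign-at g ug g²≡ε =
      let v , χg≡v   = χ-unit g ug
          s , v≡sign = 2-torsion-sign (χ-2-torsion g²≡ε χg≡v)
      in s , trans χg≡v (cong just v≡sign)

    z : Fin N
    z = proj₁ (χ-unit a₃ u₃)

    s₁ s₂ : Bool
    s₁ = proj₁ (sign-at b ub b²≡ε)
    s₂ = proj₁ (sign-at c uc c²≡ε)

    χb : lookup χ b ≡ just (sign s₁)
    χb = proj₂ (sign-at b ub b²≡ε)

    χc : lookup χ c ≡ just (sign s₂)
    χc = proj₂ (sign-at c uc c²≡ε)

    shifted : Bool → Val N
    shifted s = just (sign s ⊕ z)

    χ-ratio : ∀ a r s → r ∙ a₃ ≡ a → lookup χ r ≡ just (sign s) → lookup χ a ≡ shifted s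
    χ-ratio a r s r∙a₃≡a χr = trans (cong (lookup χ) (sym r∙a₃≡a)) (trans (χ-∙ r a₃) (cong₂ _·v_ χr (proj₂ (χ-unit a₃ u₃))))

    H⇔code : ∀ i → H q a₁ a₂ a₃ i χ ⇔ ((s₁ , s₂) ≡ code i)
    H⇔code i = ⇔-trans (H⇔Pattern a₁ a₂ a₃ i χ)
              (⇔-trans (Pattern-cong IsNeg i χa₁ χa₂ χa₃)
              (⇔-trans (Pattern-map IsNeg (λ s t → t ≡ not s) shifted shifted-injective shifted-IsNeg i {s₁} {s₂} {false})
                       (Pattern-Bool⇔code i {s₁} {s₂})))
      where
      χa₁ : lookup χ a₁ ≡ shifted s₁
      χa₁ = χ-ratio a₁ b s₁ b∙a₃≡a₁ χb
      χa₂ : lookup χ a₂ ≡ shifted s₂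
      χa₂ = χ-ratio a₂ c s₂ c∙a₃≡a₂ χc
      χa₃ : lookup χ a₃ ≡ shifted false
      χa₃ = χ-ratio a₃ ε false (identityˡ a₃) χ-ε
      shifted-injective : ∀ {s t} → shifted s ≡ shifted t → s ≡ t
      shifted-injective {s} {t} = shifted-sign-injective z {s} {t} ∘ just-injective
      shifted-IsNeg : ∀ {s t} → IsNeg (shifted s) (shifted t) ⇔ (t ≡ not s)
      shifted-IsNeg {s} {t} = NegR-shifted-sign z {s} {t}

    unique-H : Σ (Fin 4) (λ i → H q a₁ a₂ a₃ i χ × ((j : Fin 4) → H q a₁ a₂ a₃ j χ → j ≡ i))
    unique-H = decode (s₁ , s₂)
             , Equivalence.from (H⇔code (decode (s₁ , s₂))) (sym (code-decode (s₁ , s₂)))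
             , λ j Hj → trans (sym (decode-code j)) (cong decode (sym (Equivalence.to (H⇔code j) Hj)))

    H⇔values : ∀ i → H q a₁ a₂ a₃ i χ ⇔ (lookup χ b ≡ just (sign (proj₁ (code i))) × lookup χ c ≡ just (sign (proj₂ (code i))))
    H⇔values i = ⇔-trans (H⇔code i) (mk⇔ to from)
      where
      t₁ t₂ : Bool
      t₁ = proj₁ (code i)
      t₂ = proj₂ (code i)
      to : (s₁ , s₂) ≡ code i → lookup χ b ≡ just (sign t₁) × lookup χ c ≡ just (sign t₂)
      to s≡code = trans χb (cong (just ∘ sign ∘ proj₁) s≡code) , trans χc (cong (just ∘ sign ∘ proj₂) s≡code)
      from : lookup χ b ≡ just (sign t₁) × lookup χ c ≡ just (sign t₂) → (s₁ , s₂) ≡ code i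
      from (χb′ , χc′) = ×-≡,≡→≡ ( sign-injective {s₁} {t₁} (just-injective (trans (sym χb) χb′))
                                 , sign-injective {s₂} {t₂} (just-injective (trans (sym χc) χc′)))

  4*count-H≡φ : ∀ i → 4 * length (filter (H? q a₁ a₂ a₃ i) (Chars q)) ≡ φ q
  4*count-H≡φ i = trans (cong (4 *_) (count-cong (H? q a₁ a₂ a₃ i) (Extends? K ψ₂)
                         (All.map (λ {χ} isChar → Equivalence.to (H⇔Extends χ isChar) , Equivalence.from (H⇔Extends χ isChar))
                                  Chars-isChar)))
                        4*extensions≡N
    where
    open PrescribedValues (proj₁ (code i)) (proj₂ (code i))
    H⇔Extends : ∀ χ → IsChar q χ → H q a₁ a₂ a₃ i χ ⇔ Extends K ψ₂ χ
    H⇔Extends χ isChar = ⇔-trans (Signs.H⇔values χ isChar i) (⇔-sym (Extends-K⇔ χ isChar))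

lemma3p3 : (q : ℕ) → .{{_ : NonZero q}} → (a₁ a₂ a₃ : Fin q) →
           Unit q a₁ → Unit q a₂ → Unit q a₃ →
           a₁ ≢ a₂ → a₁ ≢ a₃ → a₂ ≢ a₃ →
           mulMod a₁ a₁ ≡ mulMod a₂ a₂ → mulMod a₂ a₂ ≡ mulMod a₃ a₃ →
           ((QR q a₁ × QR q a₂ × QR q a₃) ⊎ (¬ QR q a₁ × ¬ QR q a₂ × ¬ QR q a₃)) →
           ((χ : Fun q) → IsChar q χ →
              Σ (Fin 4) (λ i → H q a₁ a₂ a₃ i χ × ((j : Fin 4) → H q a₁ a₂ a₃ j χ → j ≡ i)))
           × ((i : Fin 4) → 4 * length (filter (H? q a₁ a₂ a₃ i) (Chars q)) ≡ φ q)
lemma3p3 q a₁ a₂ a₃ u₁ u₂ u₃ a₁≢a₂ a₁≢a₃ a₂≢a₃ a₁²≡a₂² a₂²≡a₃² _ = Signs.unique-H , 4*count-H≡φ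
  where open KleinFour q u₁ u₂ u₃ a₁≢a₂ a₁≢a₃ a₂≢a₃ a₁²≡a₂² a₂²≡a₃²
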